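{- Let $p$ be a prime, $q$ a power of $p$, $k\ge 0$ an integer, $a$ a positive integer divisible by $(q-1)p^{k}$, and $r$ an integer not divisible by $q-1$. Then \[ (q-1)\sum_{b\in\mathbb{Z}} \binom{a}{b(q-1)-r}\equiv -(-1)^{pr}\pmod{p^{k+1}}. \]
   Context: For a nonnegative integer $n$ and an integer $m$, $\binom{n}{m}$ denotes the usual binomial coefficient, with $\binom{n}{m}=0$ when $m<0$ or $m>n$; thus the sum over $b\in\mathbb{Z}$ is finite. -}

module Defs where

open import Data.Nat as ℕ using (ℕ; zero; suc)
open import Data.Nat.Combinatorics using (_C_)
open import Data.Integer using (ℤ; +_; -[1+_]; _+_; _-_; _*_; -_; ∣_∣)
import Data.Integer

-- Binomial coefficient with integer lower index: (n choose m) = 0 for m < 0;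
-- for m > n the library's _C_ already returns 0.
binomℤ : ℕ → ℤ → ℕ
binomℤ n (+ m)    = n C m
binomℤ n -[1+ m ] = 0

sumSym : ℕ → (ℤ → ℤ) → ℤ
sumSym zero    f = f (+ 0)
sumSym (suc B) f = sumSym B f + f (+ suc B) + f (- (+ suc B))

-- The (finite) sum Σ_{b ∈ ℤ} binom(a, b(q-1) - r).  All terms with
-- |b| > a + |r| vanish whenever q - 1 ≥ 1, so truncating at that bound
-- gives the full sum over ℤ.
binomSum : (a q : ℕ) (r : ℤ) → ℤ
binomSum a q r =
  sumSym (a ℕ.+ ∣ r ∣) (λ b → + binomℤ a (b * (+ q - + 1) - r))

-- (-1)^n for an integer exponent n (well-defined: (-1)^(-m) = (-1)^m)
negOnePow : ℤ → ℤ
negOnePow n = (- (+ 1)) Data.Integer.^ ∣ n ∣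

module Submission where

-- Work in ℤ[x]/(xⁿ − 1) with n = q − 1: there ∑_b C(a, b n − r) is the coefficient of x⁻ʳ in (1 + x)ᵃ.
-- Put y = 1 + x and D = ∑ᵢ (−1)ᵖⁱ xⁱ (well defined because (−1)ᵖⁿ = 1).  As q is a power of p,
-- y^q ≡ y (mod p), so e = yⁿ is idempotent mod p, E = e^(pᵏ) is idempotent mod pᵏ⁺¹, and yᵃ ≡ E
-- (mod pᵏ⁺¹) since (q − 1) pᵏ divides a.  From y D ≡ 0 (mod p) one gets n e ≡ n − D (mod p).  Both
-- n E and n − D satisfy Z² = n Z, and n is a unit mod p, so n E ≡ n − D already mod pᵏ⁺¹; the
-- coefficient of x⁻ʳ of this congruence is the theorem.

open import Defs
open import Data.Nat as ℕ using (ℕ; _^_)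
open import Data.Nat.Divisibility using () renaming (_∣_ to _∣ℕ_)
open import Data.Nat.Primality using (Prime)
open import Data.Integer using (ℤ; +_; _+_; _-_; _*_; -_)
open import Data.Integer.Divisibility using (_∣_)
open import Relation.Nullary using (¬_)
open import Relation.Binary.PropositionalEquality using (_≡_)

open import Data.Integer.Base as ℤ using (-[1+_]; 0ℤ; 1ℤ; -1ℤ)
import Data.Integer.Properties as ℤ
open import Data.Integer.Divisibility.Signed as Signed using () renaming (_∣_ to _∣ℤ_)
import Data.Integer.Tactic.RingSolver as ℤ-Solver
open import Data.Nat.Base using (zero; suc; _≤_; _<_; s≤s; z≤n; NonZero)
import Data.Nat.Properties as ℕ
open import Data.Nat.Combinatorics using (_C_; nCk+nC[k+1]≡[n+1]C[k+1]; nC1≡n; nCn≡1; k>n⇒nCk≡0)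
open import Data.Nat.Divisibility
  using ( divides; _∣?_; 0∣⇒≡0; 1∣_; ∣1⇒≡1; ∣-refl; ∣-reflexive; ∣-trans; ∣⇒≤; m∣m*n; n∣m*n
        ; ∣m⇒∣m*n; ∣n⇒∣m*n; ∣m∣n⇒∣m+n; ∣m+n∣m⇒∣n; *-monoʳ-∣; *-cancelˡ-∣)
open import Data.Nat.Primality using (euclidsLemma; prime⇒irreducible; prime⇒nonTrivial; prime⇒nonZero; prime[2])
import Data.Nat.Tactic.RingSolver as ℕ-Solver
open import Algebra.Bundles using (CommutativeRing)
open import Algebra.Properties.AbelianGroup ℤ.+-0-abelianGroup using ()
  renaming (∙-cancelˡ to +-cancelˡ; ⁻¹-anti-homo‿- to neg[x-y]≡y-x)
open import Algebra.Properties.CommutativeSemigroup ℤ.+-commutativeSemigroup using ()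
  renaming (interchange to +-interchange)
import Algebra.Solver.Ring as Solver
import Algebra.Solver.Ring.AlmostCommutativeRing as ACR
open import Data.Bool.Base using (if_then_else_)
import Data.Maybe.Base as Maybe
open import Data.Product.Base using (∃; _,_)
open import Data.Sum.Base using (_⊎_; inj₁; inj₂)
open import Function.Base using (_∘_)
open import Level using (0ℓ)
open import Relation.Binary.Consequences using (dec⇒weaklyDec)
open import Relation.Binary.Definitions using (WeaklyDecidable)
open import Relation.Binary.PropositionalEquality
  using (_≢_; refl; sym; trans; cong; cong₂; subst; module ≡-Reasoning)
open import Relation.Binary.Structures using (IsEquivalence)
open import Relation.Nullary using (yes; no; contradiction)
open import Relation.Nullary.Decidable using (does; dec-true; dec-false)

p^j∣c*z⇒p^j∣z : ∀ {p c} → Prime p → ¬ p ∣ℕ c → ∀ j {z} → p ^ j ∣ℕ c ℕ.* z → p ^ j ∣ℕ z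
p^j∣c*z⇒p^j∣z p-prime p∤c zero    {z} _ = 1∣ z
p^j∣c*z⇒p^j∣z {p} {c} p-prime p∤c (suc j) {z} p^[1+j]∣cz
  with euclidsLemma c z p-prime (∣-trans (m∣m*n (p ^ j)) p^[1+j]∣cz)
... | inj₁ p∣c              = contradiction p∣c p∤c
... | inj₂ (divides w refl) = ∣-trans (*-monoʳ-∣ p p^j∣w) (∣-reflexive (ℕ.*-comm p w))
  where
  instance _ = prime⇒nonZero p-prime
  reassoc : ∀ c w p → c ℕ.* (w ℕ.* p) ≡ p ℕ.* (c ℕ.* w)
  reassoc = ℕ-Solver.solve-∀
  p^j∣w : p ^ j ∣ℕ w
  p^j∣w = p^j∣c*z⇒p^j∣z p-prime p∤c j
    (*-cancelˡ-∣ p (subst (p ℕ.* p ^ j ∣ℕ_) (reassoc c w p) p^[1+j]∣cz))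

[1+k]*[1+m]C[1+k]≡[1+m]*mCk : ∀ m k → suc k ℕ.* (suc m C suc k) ≡ suc m ℕ.* (m C k)
[1+k]*[1+m]C[1+k]≡[1+m]*mCk zero    zero    = refl
[1+k]*[1+m]C[1+k]≡[1+m]*mCk zero    (suc k) = ℕ.*-zeroʳ (suc (suc k))
[1+k]*[1+m]C[1+k]≡[1+m]*mCk (suc m) zero    =
  trans (ℕ.*-identityˡ _) (trans (nC1≡n (suc (suc m))) (sym (ℕ.*-identityʳ _)))
[1+k]*[1+m]C[1+k]≡[1+m]*mCk (suc m) (suc k) = begin
  suc (suc k) ℕ.* (suc (suc m) C suc (suc k))
    ≡⟨ cong (suc (suc k) ℕ.*_) (nCk+nC[k+1]≡[n+1]C[k+1] (suc m) (suc k)) ⟨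
  suc (suc k) ℕ.* (A ℕ.+ B)
    ≡⟨ split k A B ⟩
  (suc k ℕ.* A ℕ.+ A) ℕ.+ suc (suc k) ℕ.* B
    ≡⟨ cong₂ (λ u v → (u ℕ.+ A) ℕ.+ v) ([1+k]*[1+m]C[1+k]≡[1+m]*mCk m k) ([1+k]*[1+m]C[1+k]≡[1+m]*mCk m (suc k)) ⟩
  (suc m ℕ.* (m C k) ℕ.+ A) ℕ.+ suc m ℕ.* (m C suc k)
    ≡⟨ merge m (m C k) (m C suc k) A ⟩
  suc m ℕ.* ((m C k) ℕ.+ (m C suc k)) ℕ.+ A
    ≡⟨ cong (λ w → suc m ℕ.* w ℕ.+ A) (nCk+nC[k+1]≡[n+1]C[k+1] m k) ⟩
  suc m ℕ.* A ℕ.+ A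
    ≡⟨ ℕ.+-comm (suc m ℕ.* A) A ⟩
  suc (suc m) ℕ.* A
    ∎
  where
  open ≡-Reasoning
  A = suc m C suc k
  B = suc m C suc (suc k)
  split : ∀ k A B → suc (suc k) ℕ.* (A ℕ.+ B) ≡ (suc k ℕ.* A ℕ.+ A) ℕ.+ suc (suc k) ℕ.* B
  split = ℕ-Solver.solve-∀
  merge : ∀ m x y A → (suc m ℕ.* x ℕ.+ A) ℕ.+ suc m ℕ.* y ≡ suc m ℕ.* (x ℕ.+ y) ℕ.+ A
  merge = ℕ-Solver.solve-∀

-- q divides j C(q, j), so if p did not divide C(q, j) then q = pᵉ would divide j.
p∣[p^e]Cj : ∀ {p} → Prime p → ∀ e {j} → 0 < j → j < p ^ e → p ∣ℕ (p ^ e) C j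
p∣[p^e]Cj {p} p-prime e {suc j} _ j<q with p ∣? (p ^ e) C suc j
... | yes p∣qCj = p∣qCj
... | no  p∤qCj =
  contradiction (∣⇒≤ (p^j∣c*z⇒p^j∣z p-prime p∤qCj e (q∣qC[1+j]*[1+j] (p ^ e)))) (ℕ.<⇒≱ j<q)
  where
  instance _ = ℕ.m^n≢0 p e {{prime⇒nonZero p-prime}}
  q∣qC[1+j]*[1+j] : ∀ q .{{_ : NonZero q}} → q ∣ℕ (q C suc j) ℕ.* suc j
  q∣qC[1+j]*[1+j] (suc m) = divides (m C j)
    (trans (ℕ.*-comm _ (suc j)) (trans ([1+k]*[1+m]C[1+k]≡[1+m]*mCk m j) (ℕ.*-comm (suc m) _)))

p^[1+e]≡2+n : ∀ {p} → Prime p → ∀ e → ∃ λ n → p ^ suc e ≡ suc (suc n)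
p^[1+e]≡2+n {p} p-prime e = p ^ suc e ℕ.∸ 2 , sym (ℕ.m+[n∸m]≡n 2≤p^[1+e])
  where
  instance _ = prime⇒nonZero p-prime
  2≤p^[1+e] : 2 ≤ p ^ suc e
  2≤p^[1+e] = ℕ.≤-trans (ℕ.nonTrivial⇒n>1 p {{prime⇒nonTrivial p-prime}}) (ℕ.m≤m*n p (p ^ e) {{ℕ.m^n≢0 p e}})

2∣m⊎2∣1+m : ∀ m → 2 ∣ℕ m ⊎ 2 ∣ℕ suc m
2∣m⊎2∣1+m zero    = inj₁ (divides 0 refl)
2∣m⊎2∣1+m (suc m) with 2∣m⊎2∣1+m m
... | inj₁ 2∣m   = inj₂ (∣m∣n⇒∣m+n (∣-refl {2}) 2∣m)
... | inj₂ 2∣1+m = inj₁ 2∣1+m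

prime∣m^[1+e]⇒prime∣m : ∀ {p m} → Prime p → ∀ e → p ∣ℕ m ^ suc e → p ∣ℕ m
prime∣m^[1+e]⇒prime∣m {p} {m} p-prime zero    p∣m^1 = subst (p ∣ℕ_) (ℕ.*-identityʳ m) p∣m^1
prime∣m^[1+e]⇒prime∣m {p} {m} p-prime (suc e) p∣m^[2+e] with euclidsLemma m (m ^ suc e) p-prime p∣m^[2+e]
... | inj₁ p∣m        = p∣m
... | inj₂ p∣m^[1+e] = prime∣m^[1+e]⇒prime∣m p-prime e p∣m^[1+e]

negOnePow-suc : ∀ i → negOnePow (ℤ.suc i) ≡ - negOnePow i
negOnePow-suc (+ m)        = ℤ.-1*i≡-i (negOnePow (+ m))
negOnePow-suc -[1+ zero ]  = refl
negOnePow-suc -[1+ suc m ] = sym (trans (cong -_ (ℤ.-1*i≡-i _)) (ℤ.neg-involutive _))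

negOnePow-pred : ∀ i → negOnePow (ℤ.pred i) ≡ - negOnePow i
negOnePow-pred i = begin
  negOnePow (ℤ.pred i)             ≡⟨ ℤ.neg-involutive _ ⟨
  - - negOnePow (ℤ.pred i)         ≡⟨ cong -_ (negOnePow-suc (ℤ.pred i)) ⟨
  - negOnePow (ℤ.suc (ℤ.pred i))   ≡⟨ cong (λ j → - negOnePow j) (ℤ.suc-pred i) ⟩
  - negOnePow i                    ∎
  where open ≡-Reasoning

negOnePow-+ : ∀ i j → negOnePow (i + j) ≡ negOnePow i * negOnePow j
negOnePow-+ i (+ m)    = plus i m
  where
  plus : ∀ i m → negOnePow (i + + m) ≡ negOnePow i * negOnePow (+ m)
  plus i zero    = trans (cong negOnePow (ℤ.+-identityʳ i)) (sym (ℤ.*-identityʳ _))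
  plus i (suc m) = begin
    negOnePow (i + (1ℤ + + m))          ≡⟨ cong negOnePow (swap i (+ m)) ⟩
    negOnePow (ℤ.suc (i + + m))         ≡⟨ negOnePow-suc (i + + m) ⟩
    - negOnePow (i + + m)               ≡⟨ cong -_ (plus i m) ⟩
    - (negOnePow i * negOnePow (+ m))   ≡⟨ ℤ.neg-distribʳ-* (negOnePow i) _ ⟩
    negOnePow i * - negOnePow (+ m)     ≡⟨ cong (negOnePow i *_) (ℤ.-1*i≡-i _) ⟨
    negOnePow i * negOnePow (+ suc m)   ∎
    where
    open ≡-Reasoning
    swap : ∀ i j → i + (1ℤ + j) ≡ 1ℤ + (i + j)
    swap = ℤ-Solver.solve-∀
negOnePow-+ i -[1+ m ] = minus i (suc m)
  where
  minus : ∀ i m → negOnePow (i - + m) ≡ negOnePow i * negOnePow (+ m)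
  minus i zero    = trans (cong negOnePow (ℤ.+-identityʳ i)) (sym (ℤ.*-identityʳ _))
  minus i (suc m) = begin
    negOnePow (i - + suc m)             ≡⟨ cong negOnePow (ℤ.minus-suc i m) ⟩
    negOnePow (ℤ.pred (i - + m))        ≡⟨ negOnePow-pred (i - + m) ⟩
    - negOnePow (i - + m)               ≡⟨ cong -_ (minus i m) ⟩
    - (negOnePow i * negOnePow (+ m))   ≡⟨ ℤ.neg-distribʳ-* (negOnePow i) _ ⟩
    negOnePow i * - negOnePow (+ m)     ≡⟨ cong (negOnePow i *_) (ℤ.-1*i≡-i _) ⟨
    negOnePow i * negOnePow (+ suc m)   ∎
    where open ≡-Reasoning

negOnePow-neg : ∀ i → negOnePow (- i) ≡ negOnePow i
negOnePow-neg i = cong (-1ℤ ℤ.^_) (ℤ.∣-i∣≡∣i∣ i)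

negOnePow-even : ∀ {m} → 2 ∣ℕ m → negOnePow (+ m) ≡ 1ℤ
negOnePow-even (divides k refl) = begin
  -1ℤ ℤ.^ (k ℕ.* 2)    ≡⟨ cong (-1ℤ ℤ.^_) (ℕ.*-comm k 2) ⟩
  -1ℤ ℤ.^ (2 ℕ.* k)    ≡⟨ ℤ.^-*-assoc -1ℤ 2 k ⟨
  1ℤ ℤ.^ k             ≡⟨ ℤ.^-zeroˡ k ⟩
  1ℤ                   ∎
  where open ≡-Reasoning

module _ {p} (p-prime : Prime p) where

  private
    2∣p⇒p≡2 : 2 ∣ℕ p → p ≡ 2
    2∣p⇒p≡2 2∣p with prime⇒irreducible p-prime 2∣p
    ... | inj₁ ()
    ... | inj₂ 2≡p = sym 2≡p

    2∣1+p⇒2∤p : 2 ∣ℕ suc p → ¬ 2 ∣ℕ p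
    2∣1+p⇒2∤p 2∣1+p 2∣p with ∣1⇒≡1 (∣m+n∣m⇒∣n (subst (2 ∣ℕ_) (ℕ.+-comm 1 p) 2∣1+p) 2∣p)
    ... | ()

  p∣1+negOnePow[p] : + p ∣ℤ 1ℤ + negOnePow (+ p)
  p∣1+negOnePow[p] with 2∣m⊎2∣1+m p
  ... | inj₁ 2∣p   rewrite 2∣p⇒p≡2 2∣p = Signed.∣-refl
  ... | inj₂ 2∣1+p = Signed.divides 0ℤ (cong (_+_ 1ℤ) negOnePow[p]≡-1)
    where
    negOnePow[p]≡-1 : negOnePow (+ p) ≡ -1ℤ
    negOnePow[p]≡-1 = trans (sym (ℤ.neg-involutive _))
      (cong -_ (trans (sym (negOnePow-suc (+ p))) (negOnePow-even 2∣1+p)))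

  negOnePow[p*n]≡1 : ∀ e {n} → suc n ≡ p ^ suc e → negOnePow (+ p * + n) ≡ 1ℤ
  negOnePow[p*n]≡1 e {n} 1+n≡q = trans (cong negOnePow (sym (ℤ.pos-* p n))) (negOnePow-even 2∣pn)
    where
    2∣pn : 2 ∣ℕ p ℕ.* n
    2∣pn with 2∣m⊎2∣1+m p | 2∣m⊎2∣1+m n
    ... | inj₁ 2∣p   | _          = ∣m⇒∣m*n n 2∣p
    ... | inj₂ _     | inj₁ 2∣n   = ∣n⇒∣m*n p 2∣n
    ... | inj₂ 2∣1+p | inj₂ 2∣1+n =
      contradiction (prime∣m^[1+e]⇒prime∣m prime[2] e (subst (2 ∣ℕ_) 1+n≡q 2∣1+n)) (2∣1+p⇒2∤p 2∣1+p)

∑< : ℕ → (ℕ → ℤ) → ℤ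
∑< zero    f = 0ℤ
∑< (suc n) f = f 0 + ∑< n (λ i → f (suc i))
syntax ∑< n (λ i → e) = ∑[ i < n ] e

∑-zero : ∀ n {f} → (∀ i → i < n → f i ≡ 0ℤ) → ∑< n f ≡ 0ℤ
∑-zero zero    f≡0 = refl
∑-zero (suc n) f≡0 = cong₂ _+_ (f≡0 0 (s≤s z≤n)) (∑-zero n (λ i i<n → f≡0 (suc i) (s≤s i<n)))

∑-cong-< : ∀ n {f g} → (∀ i → i < n → f i ≡ g i) → ∑< n f ≡ ∑< n g
∑-cong-< zero    f≡g = refl
∑-cong-< (suc n) f≡g = cong₂ _+_ (f≡g 0 (s≤s z≤n)) (∑-cong-< n (λ i i<n → f≡g (suc i) (s≤s i<n)))

∑-cong : ∀ n {f g} → (∀ i → f i ≡ g i) → ∑< n f ≡ ∑< n g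
∑-cong n f≡g = ∑-cong-< n (λ i _ → f≡g i)

∑-distrib-+ : ∀ n f g → ∑[ i < n ] (f i + g i) ≡ ∑< n f + ∑< n g
∑-distrib-+ zero    f g = refl
∑-distrib-+ (suc n) f g =
  trans (cong (_+_ (f 0 + g 0)) (∑-distrib-+ n _ _)) (+-interchange (f 0) (g 0) _ _)

∑-neg : ∀ n f → ∑[ i < n ] (- f i) ≡ - ∑< n f
∑-neg zero    f = refl
∑-neg (suc n) f = trans (cong (_+_ (- f 0)) (∑-neg n _)) (sym (ℤ.neg-distrib-+ (f 0) _))

∑-distrib-- : ∀ n f g → ∑[ i < n ] (f i - g i) ≡ ∑< n f - ∑< n g
∑-distrib-- n f g = trans (∑-distrib-+ n f (λ i → - g i)) (cong (_+_ (∑< n f)) (∑-neg n g))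

*-distribˡ-∑ : ∀ n c f → c * ∑< n f ≡ ∑[ i < n ] (c * f i)
*-distribˡ-∑ zero    c f = ℤ.*-zeroʳ c
*-distribˡ-∑ (suc n) c f = trans (ℤ.*-distribˡ-+ c (f 0) _) (cong (_+_ (c * f 0)) (*-distribˡ-∑ n c _))

*-distribʳ-∑ : ∀ n c f → ∑< n f * c ≡ ∑[ i < n ] (f i * c)
*-distribʳ-∑ n c f =
  trans (ℤ.*-comm (∑< n f) c) (trans (*-distribˡ-∑ n c f) (∑-cong n (λ i → ℤ.*-comm c (f i))))

∑-swap : ∀ n m (f : ℕ → ℕ → ℤ) → ∑[ i < n ] ∑[ j < m ] f i j ≡ ∑[ j < m ] ∑[ i < n ] f i j
∑-swap zero    m f = sym (∑-zero m (λ _ _ → refl))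
∑-swap (suc n) m f = trans (cong (_+_ (∑[ j < m ] f 0 j)) (∑-swap n m _)) (sym (∑-distrib-+ m _ _))

∑-const : ∀ n c → ∑[ i < n ] c ≡ + n * c
∑-const zero    c = sym (ℤ.*-zeroˡ c)
∑-const (suc n) c = begin
  c + ∑[ i < n ] c    ≡⟨ cong (_+_ c) (∑-const n c) ⟩
  c + + n * c         ≡⟨ cong (_+ + n * c) (ℤ.*-identityˡ c) ⟨
  1ℤ * c + + n * c    ≡⟨ ℤ.*-distribʳ-+ c 1ℤ (+ n) ⟨
  + suc n * c         ∎
  where open ≡-Reasoning

∑-last : ∀ n f → ∑< (suc n) f ≡ ∑< n f + f n
∑-last zero    f = trans (ℤ.+-identityʳ (f 0)) (sym (ℤ.+-identityˡ (f 0)))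
∑-last (suc n) f = begin
  f 0 + ∑< (suc n) (λ i → f (suc i))          ≡⟨ cong (_+_ (f 0)) (∑-last n (λ i → f (suc i))) ⟩
  f 0 + (∑[ i < n ] f (suc i) + f (suc n))    ≡⟨ ℤ.+-assoc (f 0) _ (f (suc n)) ⟨
  ∑< (suc n) f + f (suc n)                    ∎
  where open ≡-Reasoning

∑-reverse : ∀ n f → ∑[ i < n ] f (n ℕ.∸ suc i) ≡ ∑< n f
∑-reverse zero    f = refl
∑-reverse (suc n) f = begin
  f n + ∑[ i < n ] f (n ℕ.∸ suc i)   ≡⟨ cong (_+_ (f n)) (∑-reverse n f) ⟩
  f n + ∑< n f                       ≡⟨ ℤ.+-comm (f n) (∑< n f) ⟩
  ∑< n f + f n                       ≡⟨ ∑-last n f ⟨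
  ∑< (suc n) f                       ∎
  where open ≡-Reasoning

∑-select : ∀ n {f} j → j < n → (∀ i → i < n → i ≢ j → f i ≡ 0ℤ) → ∑< n f ≡ f j
∑-select (suc n) {f} zero    _         f≡0 = trans (cong (_+_ (f 0)) (∑-zero n tail≡0)) (ℤ.+-identityʳ (f 0))
  where
  tail≡0 : ∀ i → i < n → f (suc i) ≡ 0ℤ
  tail≡0 i i<n = f≡0 (suc i) (s≤s i<n) (λ ())
∑-select (suc n) {f} (suc j) (s≤s j<n) f≡0 =
  trans (cong₂ _+_ (f≡0 0 (s≤s z≤n) (λ ())) (∑-select n j j<n tail≡0)) (ℤ.+-identityˡ (f (suc j)))
  where
  tail≡0 : ∀ i → i < n → i ≢ j → f (suc i) ≡ 0ℤ
  tail≡0 i i<n i≢j = f≡0 (suc i) (s≤s i<n) (λ { refl → i≢j refl })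

∣ℤ-∑ : ∀ n {M f} → (∀ i → i < n → M ∣ℤ f i) → M ∣ℤ ∑< n f
∣ℤ-∑ zero    _   = Signed.divides 0ℤ refl
∣ℤ-∑ (suc n) M∣f = Signed.∣m∣n⇒∣m+n (M∣f 0 (s≤s z≤n)) (∣ℤ-∑ n (λ i i<n → M∣f (suc i) (s≤s i<n)))

Periodic : ℕ → (ℤ → ℤ) → Set
Periodic n φ = ∀ z → φ (z + + n) ≡ φ z

module _ {n} {φ : ℤ → ℤ} (φ-periodic : Periodic n φ) where

  private
    window : ℤ → ℤ
    window c = ∑[ i < n ] φ (c + + i)

    window-suc : ∀ c → window (ℤ.suc c) ≡ window c
    window-suc c = +-cancelˡ (φ c) _ _ (begin
      φ c + window (ℤ.suc c)
        ≡⟨ cong₂ _+_ (cong φ (ℤ.+-identityʳ c)) (∑-cong n (λ i → cong φ (shift c (+ i)))) ⟨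
      φ (c + + 0) + ∑[ i < n ] φ (c + + suc i)
        ≡⟨ ∑-last n (λ i → φ (c + + i)) ⟩
      window c + φ (c + + n)
        ≡⟨ cong (_+_ (window c)) (φ-periodic c) ⟩
      window c + φ c
        ≡⟨ ℤ.+-comm (window c) (φ c) ⟩
      φ c + window c
        ∎)
      where
      open ≡-Reasoning
      shift : ∀ c i → c + (1ℤ + i) ≡ (1ℤ + c) + i
      shift = ℤ-Solver.solve-∀

    window-pos : ∀ m → window (+ m) ≡ window 0ℤ
    window-pos zero    = refl
    window-pos (suc m) = trans (window-suc (+ m)) (window-pos m)

    window-neg : ∀ m → window (- + m) ≡ window 0ℤ
    window-neg zero    = refl
    window-neg (suc m) = begin
      window -[1+ m ]          ≡⟨ window-suc -[1+ m ] ⟨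
      window (ℤ.suc -[1+ m ])  ≡⟨ cong window (ℤ.1-[1+n]≡-n m) ⟩
      window (- + m)           ≡⟨ window-neg m ⟩
      window 0ℤ                ∎
      where open ≡-Reasoning

  ∑-periodic-shift : ∀ c → ∑[ i < n ] φ (c + + i) ≡ ∑[ i < n ] φ (+ i)
  ∑-periodic-shift c = trans (window≡window0 c) (∑-cong n (λ i → cong φ (ℤ.+-identityˡ (+ i))))
    where
    window≡window0 : ∀ c → window c ≡ window 0ℤ
    window≡window0 (+ m)    = window-pos m
    window≡window0 -[1+ m ] = window-neg (suc m)

  ∑-periodic-reflect : ∀ c → ∑[ i < n ] φ (c - + i) ≡ ∑[ i < n ] φ (+ i)
  ∑-periodic-reflect c = begin
    ∑[ i < n ] φ (c - + i)                ≡⟨ ∑-reverse n (λ i → φ (c - + i)) ⟨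
    ∑[ i < n ] φ (c - + (n ℕ.∸ suc i))    ≡⟨ ∑-cong-< n (λ i i<n → cong φ (reindex i i<n)) ⟩
    ∑[ i < n ] φ ((c - + n + 1ℤ) + + i)   ≡⟨ ∑-periodic-shift (c - + n + 1ℤ) ⟩
    ∑[ i < n ] φ (+ i)                    ∎
    where
    open ≡-Reasoning
    rearrange : ∀ c n i → c - (n - (1ℤ + i)) ≡ (c - n + 1ℤ) + i
    rearrange = ℤ-Solver.solve-∀
    reindex : ∀ i → i < n → c - + (n ℕ.∸ suc i) ≡ (c - + n + 1ℤ) + + i
    reindex i i<n = begin
      c - + (n ℕ.∸ suc i)      ≡⟨ cong (λ j → c - j) (ℤ.⊖-≥ i<n) ⟨
      c - (n ℤ.⊖ suc i)        ≡⟨ cong (λ j → c - j) (ℤ.m-n≡m⊖n n (suc i)) ⟨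
      c - (+ n - (1ℤ + + i))   ≡⟨ rearrange c (+ n) (+ i) ⟩
      (c - + n + 1ℤ) + + i     ∎

opaque
  [_≟_] : ℤ → ℤ → ℤ
  [ x ≟ y ] = if does (x ℤ.≟ y) then 1ℤ else 0ℤ

  [≟]-yes : ∀ {x y} → x ≡ y → [ x ≟ y ] ≡ 1ℤ
  [≟]-yes {x} {y} x≡y = cong (λ b → if b then 1ℤ else 0ℤ) (dec-true (x ℤ.≟ y) x≡y)

  [≟]-no : ∀ {x y} → x ≢ y → [ x ≟ y ] ≡ 0ℤ
  [≟]-no {x} {y} x≢y = cong (λ b → if b then 1ℤ else 0ℤ) (dec-false (x ℤ.≟ y) x≢y)

[≟]-cong : ∀ {x y x′ y′} → (x ≡ y → x′ ≡ y′) → (x′ ≡ y′ → x ≡ y) → [ x ≟ y ] ≡ [ x′ ≟ y′ ]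
[≟]-cong {x} {y} ⇒ ⇐ with x ℤ.≟ y
... | yes x≡y = trans ([≟]-yes x≡y) (sym ([≟]-yes (⇒ x≡y)))
... | no  x≢y = trans ([≟]-no x≢y) (sym ([≟]-no (λ x′≡y′ → x≢y (⇐ x′≡y′))))

*[≟]-no : ∀ c {x y} → x ≢ y → c * [ x ≟ y ] ≡ 0ℤ
*[≟]-no c x≢y = trans (cong (c *_) ([≟]-no x≢y)) (ℤ.*-zeroʳ c)

binomℤ-as-∑ : ∀ a m → + binomℤ a m ≡ ∑[ i < suc a ] (+ (a C i) * [ + i ≟ m ])
binomℤ-as-∑ a -[1+ m ] = sym (∑-zero (suc a) (λ i _ → *[≟]-no (+ (a C i)) {+ i} { -[1+ m ]} (λ ())))
binomℤ-as-∑ a (+ j) with j ℕ.≤? a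
... | yes j≤a = sym (trans (∑-select (suc a) j (s≤s j≤a) other≡0) (trans (cong (+ (a C j) *_) ([≟]-yes {+ j} refl))
                                                                         (ℤ.*-identityʳ (+ (a C j)))))
  where
  other≡0 : ∀ i → i < suc a → i ≢ j → + (a C i) * [ + i ≟ + j ] ≡ 0ℤ
  other≡0 i _ i≢j = *[≟]-no (+ (a C i)) (λ i≡j → i≢j (ℤ.+-injective i≡j))
... | no  j≰a = trans (cong +_ (k>n⇒nCk≡0 (ℕ.≰⇒> j≰a))) (sym (∑-zero (suc a) all≡0))
  where
  all≡0 : ∀ i → i < suc a → + (a C i) * [ + i ≟ + j ] ≡ 0ℤ
  all≡0 i i≤a = *[≟]-no (+ (a C i)) (λ i≡j → j≰a (subst (_≤ a) (ℤ.+-injective i≡j) (ℕ.≤-pred i≤a)))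

sumSym-cong : ∀ B {f g} → (∀ b → f b ≡ g b) → sumSym B f ≡ sumSym B g
sumSym-cong zero    f≡g = f≡g 0ℤ
sumSym-cong (suc B) f≡g = cong₂ _+_ (cong₂ _+_ (sumSym-cong B f≡g) (f≡g _)) (f≡g _)

sumSym-zero : ∀ B {f} → (∀ b → ℤ.∣ b ∣ ≤ B → f b ≡ 0ℤ) → sumSym B f ≡ 0ℤ
sumSym-zero zero    f≡0 = f≡0 0ℤ z≤n
sumSym-zero (suc B) f≡0 = cong₂ _+_ (cong₂ _+_ inner≡0 (f≡0 _ ℕ.≤-refl)) (f≡0 _ ℕ.≤-refl)
  where
  inner≡0 = sumSym-zero B (λ b |b|≤B → f≡0 b (ℕ.m≤n⇒m≤1+n |b|≤B))

sumSym-distrib-+ : ∀ B f g → sumSym B (λ b → f b + g b) ≡ sumSym B f + sumSym B g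
sumSym-distrib-+ zero    f g = refl
sumSym-distrib-+ (suc B) f g = trans
  (cong (λ s → s + (f (+ suc B) + g (+ suc B)) + (f -[1+ B ] + g -[1+ B ])) (sumSym-distrib-+ B f g))
  (regroup (sumSym B f) (sumSym B g) (f (+ suc B)) (g (+ suc B)) (f -[1+ B ]) (g -[1+ B ]))
  where
  regroup : ∀ s t a b c d → s + t + (a + b) + (c + d) ≡ s + a + c + (t + b + d)
  regroup = ℤ-Solver.solve-∀

*-distribˡ-sumSym : ∀ B c f → c * sumSym B f ≡ sumSym B (λ b → c * f b)
*-distribˡ-sumSym zero    c f = refl
*-distribˡ-sumSym (suc B) c f = trans (ℤ.*-distribˡ-+ c _ _)
  (cong (_+ c * f -[1+ B ]) (trans (ℤ.*-distribˡ-+ c _ _) (cong (_+ c * f (+ suc B)) (*-distribˡ-sumSym B c f))))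

sumSym-∑ : ∀ B L (g : ℕ → ℤ → ℤ) → sumSym B (λ b → ∑[ i < L ] g i b) ≡ ∑[ i < L ] sumSym B (g i)
sumSym-∑ B zero    g = sumSym-zero B (λ _ _ → refl)
sumSym-∑ B (suc L) g =
  trans (sumSym-distrib-+ B (g 0) _) (cong (_+_ (sumSym B (g 0))) (sumSym-∑ B L (λ i → g (suc i))))

sumSym-[≟] : ∀ B {c} → ℤ.∣ c ∣ ≤ B → sumSym B (λ b → [ b ≟ c ]) ≡ 1ℤ
sumSym-[≟] zero    {+ zero} z≤n = [≟]-yes refl
sumSym-[≟] (suc B) {c} |c|≤1+B with ℕ.m≤n⇒m<n∨m≡n |c|≤1+B
... | inj₁ |c|<1+B = begin
  sumSym B (λ b → [ b ≟ c ]) + [ + suc B ≟ c ] + [ -[1+ B ] ≟ c ]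
    ≡⟨ cong₂ (λ s t → s + t + [ -[1+ B ] ≟ c ]) (sumSym-[≟] B (ℕ.≤-pred |c|<1+B)) ([≟]-no (boundary (+ suc B) refl)) ⟩
  1ℤ + 0ℤ + [ -[1+ B ] ≟ c ]
    ≡⟨ cong (_+_ (1ℤ + 0ℤ)) ([≟]-no (boundary -[1+ B ] refl)) ⟩
  1ℤ
    ∎
  where
  open ≡-Reasoning
  boundary : ∀ b → ℤ.∣ b ∣ ≡ suc B → b ≢ c
  boundary b |b|≡1+B refl = ℕ.<-irrefl |b|≡1+B |c|<1+B
... | inj₂ |c|≡1+B = trans
  (cong (λ s → s + [ + suc B ≟ c ] + [ -[1+ B ] ≟ c ]) (sumSym-zero B (λ b |b|≤B → [≟]-no (inner b |b|≤B))))
  (ends c |c|≡1+B)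
  where
  inner : ∀ b → ℤ.∣ b ∣ ≤ B → b ≢ c
  inner b |b|≤B refl = ℕ.<-irrefl |c|≡1+B (s≤s |b|≤B)
  ends : ∀ c → ℤ.∣ c ∣ ≡ suc B → 0ℤ + [ + suc B ≟ c ] + [ -[1+ B ] ≟ c ] ≡ 1ℤ
  ends (+ _)    refl = cong₂ (λ s t → 0ℤ + s + t) ([≟]-yes refl) ([≟]-no (λ ()))
  ends -[1+ _ ] refl = cong₂ (λ s t → 0ℤ + s + t) ([≟]-no (λ ())) ([≟]-yes refl)

module CyclicRing (n : ℕ) .{{_ : NonZero n}} where

  opaque
    δ : ℤ → ℤ
    δ z = if does (+ n Signed.∣? z) then 1ℤ else 0ℤ

    δ-yes : ∀ {z} → + n ∣ℤ z → δ z ≡ 1ℤ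
    δ-yes {z} n∣z = cong (λ b → if b then 1ℤ else 0ℤ) (dec-true (+ n Signed.∣? z) n∣z)

    δ-no : ∀ {z} → ¬ + n ∣ℤ z → δ z ≡ 0ℤ
    δ-no {z} n∤z = cong (λ b → if b then 1ℤ else 0ℤ) (dec-false (+ n Signed.∣? z) n∤z)

  δ-cong : ∀ a b → (+ n ∣ℤ a → + n ∣ℤ b) → (+ n ∣ℤ b → + n ∣ℤ a) → δ a ≡ δ b
  δ-cong a b a⇒b b⇒a with + n Signed.∣? a
  ... | yes n∣a = trans (δ-yes n∣a) (sym (δ-yes (a⇒b n∣a)))
  ... | no  n∤a = trans (δ-no n∤a) (sym (δ-no (λ n∣b → n∤a (b⇒a n∣b))))

  δ-periodic : Periodic n δ
  δ-periodic z = δ-cong (z + + n) z (λ n∣z+n → Signed.∣m+n∣n⇒∣m n∣z+n Signed.∣-refl)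
                                    (λ n∣z → Signed.∣m∣n⇒∣m+n n∣z Signed.∣-refl)

  δ-neg : ∀ z → δ (- z) ≡ δ z
  δ-neg z = δ-cong (- z) z (λ n∣-z → subst (+ n ∣ℤ_) (ℤ.neg-involutive z) (Signed.∣m⇒∣-m n∣-z)) Signed.∣m⇒∣-m

  ∑-δ : ∀ (ψ : ℤ → ℤ) → ∑[ i < n ] (δ (+ i) * ψ (+ i)) ≡ ψ 0ℤ
  ∑-δ ψ = trans (∑-select n 0 (ℕ.>-nonZero⁻¹ n) δψ≡0)
                (trans (cong (_* ψ 0ℤ) (δ-yes (Signed.divides 0ℤ refl))) (ℤ.*-identityˡ (ψ 0ℤ)))
    where
    δψ≡0 : ∀ i → i < n → i ≢ 0 → δ (+ i) * ψ (+ i) ≡ 0ℤ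
    δψ≡0 zero    _   0≢0 = contradiction refl 0≢0
    δψ≡0 (suc i) i<n _   = trans (cong (_* ψ (+ suc i)) (δ-no n∤1+i)) (ℤ.*-zeroˡ (ψ (+ suc i)))
      where
      n∤1+i : ¬ + n ∣ℤ + suc i
      n∤1+i n∣1+i = ℕ.<⇒≱ i<n (∣⇒≤ (Signed.∣⇒∣ᵤ n∣1+i))

  -- ℤ[x]/(xⁿ − 1), an element being given by its coefficient function: coeff f k is the coefficient
  -- of xᵏ, for every integer k.
  record ℤ[Cₙ] : Set where
    no-eta-equality
    field
      coeff    : ℤ → ℤ
      periodic : Periodic n coeff
  open ℤ[Cₙ] public

  infixl 6 _⊕_ _⊖_
  infixl 7 _⊛_
  infix  8 ⊝_

  _⊕_ : ℤ[Cₙ] → ℤ[Cₙ] → ℤ[Cₙ]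
  coeff    (f ⊕ g) k = coeff f k + coeff g k
  periodic (f ⊕ g) k = cong₂ _+_ (periodic f k) (periodic g k)

  ⊝_ : ℤ[Cₙ] → ℤ[Cₙ]
  coeff    (⊝ f) k = - coeff f k
  periodic (⊝ f) k = cong -_ (periodic f k)

  _⊖_ : ℤ[Cₙ] → ℤ[Cₙ] → ℤ[Cₙ]
  f ⊖ g = f ⊕ ⊝ g

  _⊛_ : ℤ[Cₙ] → ℤ[Cₙ] → ℤ[Cₙ]
  coeff    (f ⊛ g) k = ∑[ i < n ] (coeff f (+ i) * coeff g (k - + i))
  periodic (f ⊛ g) k = ∑-cong n (λ i → cong (coeff f (+ i) *_)
    (trans (cong (coeff g) (swap k (+ n) (+ i))) (periodic g (k - + i))))
    where
    swap : ∀ k m i → k + m - i ≡ k - i + m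
    swap = ℤ-Solver.solve-∀

  ι : ℤ → ℤ[Cₙ]
  coeff    (ι c) k = c * δ k
  periodic (ι c) k = cong (c *_) (δ-periodic k)

  𝟘 𝟙 X : ℤ[Cₙ]
  𝟘 = ι 0ℤ
  𝟙 = ι 1ℤ
  coeff    X k = δ (k - 1ℤ)
  periodic X k = trans (cong δ (swap k (+ n))) (δ-periodic (k - 1ℤ))
    where
    swap : ∀ k m → k + m - 1ℤ ≡ k - 1ℤ + m
    swap = ℤ-Solver.solve-∀

  infix 4 _≐_ _≈[_]_

  _≐_ : ℤ[Cₙ] → ℤ[Cₙ] → Set
  f ≐ g = ∀ k → coeff f k ≡ coeff g k

  -- Modulo 0 this is equality.
  record _≈[_]_ (f : ℤ[Cₙ]) (M : ℕ) (g : ℤ[Cₙ]) : Set where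
    constructor coeffwise
    field coeff-∣ : ∀ k → + M ∣ℤ coeff f k - coeff g k
  open _≈[_]_ public

  ≐⇒≈ : ∀ {f g} M → f ≐ g → f ≈[ M ] g
  ≐⇒≈ {g = g} M f≐g =
    coeffwise (λ k → Signed.divides 0ℤ (trans (cong (_- coeff g k) (f≐g k)) (ℤ.+-inverseʳ (coeff g k))))

  ≈-refl : ∀ {f M} → f ≈[ M ] f
  ≈-refl {M = M} = ≐⇒≈ M (λ _ → refl)

  ≈-sym : ∀ {f g M} → f ≈[ M ] g → g ≈[ M ] f
  ≈-sym {f} {g} (coeffwise M∣f-g) =
    coeffwise (λ k → subst (_ ∣ℤ_) (neg[x-y]≡y-x (coeff f k) (coeff g k)) (Signed.∣m⇒∣-m (M∣f-g k)))

  ≈-trans : ∀ {f g h M} → f ≈[ M ] g → g ≈[ M ] h → f ≈[ M ] h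
  ≈-trans {f} {g} {h} (coeffwise M∣f-g) (coeffwise M∣g-h) = coeffwise (λ k →
    subst (_ ∣ℤ_) (ℤ.+-minus-telescope (coeff f k) (coeff g k) (coeff h k)) (Signed.∣m∣n⇒∣m+n (M∣f-g k) (M∣g-h k)))

  ≈-weaken : ∀ {f g M M′} → M ∣ℕ M′ → f ≈[ M′ ] g → f ≈[ M ] g
  ≈-weaken M∣M′ (coeffwise M′∣f-g) = coeffwise (λ k → Signed.∣-trans (Signed.∣ᵤ⇒∣ M∣M′) (M′∣f-g k))

  ⊕-cong : ∀ {f f′ g g′ M} → f ≈[ M ] f′ → g ≈[ M ] g′ → f ⊕ g ≈[ M ] f′ ⊕ g′
  ⊕-cong {f} {f′} {g} {g′} (coeffwise M∣f-f′) (coeffwise M∣g-g′) = coeffwise (λ k →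
    subst (_ ∣ℤ_) (regroup (coeff f k) (coeff f′ k) (coeff g k) (coeff g′ k)) (Signed.∣m∣n⇒∣m+n (M∣f-f′ k) (M∣g-g′ k)))
    where
    regroup : ∀ a a′ b b′ → (a - a′) + (b - b′) ≡ (a + b) - (a′ + b′)
    regroup = ℤ-Solver.solve-∀

  ⊝-cong : ∀ {f f′ M} → f ≈[ M ] f′ → ⊝ f ≈[ M ] ⊝ f′
  ⊝-cong {f} {f′} (coeffwise M∣f-f′) = coeffwise (λ k →
    subst (_ ∣ℤ_) (regroup (coeff f k) (coeff f′ k)) (Signed.∣m⇒∣-m (M∣f-f′ k)))
    where
    regroup : ∀ a a′ → - (a - a′) ≡ - a - - a′
    regroup = ℤ-Solver.solve-∀

  ⊛-cong : ∀ {f f′ g g′ M} → f ≈[ M ] f′ → g ≈[ M ] g′ → f ⊛ g ≈[ M ] f′ ⊛ g′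
  ⊛-cong {f} {f′} {g} {g′} {M} (coeffwise M∣f-f′) (coeffwise M∣g-g′) = coeffwise (λ k →
    subst (_ ∣ℤ_) (∑-distrib-- n (λ i → coeff f (+ i) * coeff g (k - + i)) (λ i → coeff f′ (+ i) * coeff g′ (k - + i)))
      (∣ℤ-∑ n (λ i _ → termwise (+ i) (k - + i))))
    where
    regroup : ∀ a a′ b b′ → a * (b - b′) + (a - a′) * b′ ≡ a * b - a′ * b′
    regroup = ℤ-Solver.solve-∀
    termwise : ∀ i j → + M ∣ℤ coeff f i * coeff g j - coeff f′ i * coeff g′ j
    termwise i j = subst (_ ∣ℤ_) (regroup (coeff f i) (coeff f′ i) (coeff g j) (coeff g′ j))
      (Signed.∣m∣n⇒∣m+n (Signed.∣n⇒∣m*n (coeff f i) (M∣g-g′ j)) (Signed.∣m⇒∣m*n (coeff g′ j) (M∣f-f′ i)))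

  periodic-reflected : ∀ f k z → coeff f (k - (z + + n)) ≡ coeff f (k - z)
  periodic-reflected f k z = trans (sym (periodic f (k - (z + + n)))) (cong (coeff f) (cancel k z (+ n)))
    where
    cancel : ∀ k z m → k - (z + m) + m ≡ k - z
    cancel = ℤ-Solver.solve-∀

  convolution-periodic : ∀ f g k → Periodic n (λ z → coeff f z * coeff g (k - z))
  convolution-periodic f g k z = cong₂ _*_ (periodic f z) (periodic-reflected g k z)

  ι-⊛ : ∀ c f k → coeff (ι c ⊛ f) k ≡ c * coeff f k
  ι-⊛ c f k = begin
    ∑[ i < n ] (c * δ (+ i) * coeff f (k - + i))     ≡⟨ ∑-cong n (λ i → ℤ.*-assoc c (δ (+ i)) _) ⟩
    ∑[ i < n ] (c * (δ (+ i) * coeff f (k - + i)))   ≡⟨ *-distribˡ-∑ n c _ ⟨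
    c * ∑[ i < n ] (δ (+ i) * coeff f (k - + i))     ≡⟨ cong (c *_) (∑-δ (λ z → coeff f (k - z))) ⟩
    c * coeff f (k - 0ℤ)                             ≡⟨ cong (λ z → c * coeff f z) (ℤ.+-identityʳ k) ⟩
    c * coeff f k                                    ∎
    where open ≡-Reasoning

  X-⊛ : ∀ f k → coeff (X ⊛ f) k ≡ coeff f (k - 1ℤ)
  X-⊛ f k = begin
    ∑[ i < n ] (δ (+ i - 1ℤ) * coeff f (k - + i))
      ≡⟨ ∑-periodic-shift (convolution-periodic X f k) 1ℤ ⟨
    ∑[ i < n ] (δ (1ℤ + + i - 1ℤ) * coeff f (k - (1ℤ + + i)))
      ≡⟨ ∑-cong n (λ i → cong₂ (λ a b → δ a * coeff f b) (cancel (+ i)) (regroup k (+ i))) ⟩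
    ∑[ i < n ] (δ (+ i) * coeff f (k - 1ℤ - + i))
      ≡⟨ ∑-δ (λ z → coeff f (k - 1ℤ - z)) ⟩
    coeff f (k - 1ℤ - 0ℤ)
      ≡⟨ cong (coeff f) (ℤ.+-identityʳ (k - 1ℤ)) ⟩
    coeff f (k - 1ℤ)
      ∎
    where
    open ≡-Reasoning
    cancel : ∀ i → 1ℤ + i - 1ℤ ≡ i
    cancel = ℤ-Solver.solve-∀
    regroup : ∀ k i → k - (1ℤ + i) ≡ k - 1ℤ - i
    regroup = ℤ-Solver.solve-∀

  ⊛-comm : ∀ f g → f ⊛ g ≐ g ⊛ f
  ⊛-comm f g k = begin
    ∑[ i < n ] (coeff f (+ i) * coeff g (k - + i))
      ≡⟨ ∑-periodic-reflect (convolution-periodic f g k) k ⟨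
    ∑[ i < n ] (coeff f (k - + i) * coeff g (k - (k - + i)))
      ≡⟨ ∑-cong n (λ i → trans (cong (λ z → coeff f (k - + i) * coeff g z) (cancel k (+ i)))
                               (ℤ.*-comm (coeff f (k - + i)) (coeff g (+ i)))) ⟩
    ∑[ i < n ] (coeff g (+ i) * coeff f (k - + i))
      ∎
    where
    open ≡-Reasoning
    cancel : ∀ k i → k - (k - i) ≡ i
    cancel = ℤ-Solver.solve-∀

  ⊛-assoc : ∀ f g h → (f ⊛ g) ⊛ h ≐ f ⊛ (g ⊛ h)
  ⊛-assoc f g h k = begin
    ∑[ i < n ] (∑[ l < n ] (F l * G (+ i - + l)) * H (k - + i))
      ≡⟨ ∑-cong n (λ i → *-distribʳ-∑ n (H (k - + i)) _) ⟩
    ∑[ i < n ] ∑[ l < n ] (F l * G (+ i - + l) * H (k - + i))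
      ≡⟨ ∑-swap n n _ ⟩
    ∑[ l < n ] ∑[ i < n ] (F l * G (+ i - + l) * H (k - + i))
      ≡⟨ ∑-cong n (λ l → ∑-cong n (λ i → ℤ.*-assoc (F l) _ _)) ⟩
    ∑[ l < n ] ∑[ i < n ] (F l * (G (+ i - + l) * H (k - + i)))
      ≡⟨ ∑-cong n (λ l → *-distribˡ-∑ n (F l) _) ⟨
    ∑[ l < n ] (F l * ∑[ i < n ] (G (+ i - + l) * H (k - + i)))
      ≡⟨ ∑-cong n (λ l → cong (F l *_) (shift l)) ⟩
    ∑[ l < n ] (F l * ∑[ i < n ] (G (+ i) * H (k - + l - + i)))
      ∎
    where
    open ≡-Reasoning
    F = λ l → coeff f (+ l)
    G = coeff g
    H = coeff h
    swap : ∀ z m l → z + m - l ≡ z - l + m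
    swap = ℤ-Solver.solve-∀
    cancel : ∀ l i → l + i - l ≡ i
    cancel = ℤ-Solver.solve-∀
    regroup : ∀ k l i → k - (l + i) ≡ k - l - i
    regroup = ℤ-Solver.solve-∀
    shift : ∀ l → ∑[ i < n ] (G (+ i - + l) * H (k - + i)) ≡ ∑[ i < n ] (G (+ i) * H (k - + l - + i))
    shift l = begin
      ∑[ i < n ] (G (+ i - + l) * H (k - + i))
        ≡⟨ ∑-periodic-shift φ-periodic (+ l) ⟨
      ∑[ i < n ] (G (+ l + + i - + l) * H (k - (+ l + + i)))
        ≡⟨ ∑-cong n (λ i → cong₂ (λ a b → G a * H b) (cancel (+ l) (+ i)) (regroup k (+ l) (+ i))) ⟩
      ∑[ i < n ] (G (+ i) * H (k - + l - + i))
        ∎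
      where
      φ-periodic : Periodic n (λ z → G (z - + l) * H (k - z))
      φ-periodic z =
        cong₂ _*_ (trans (cong G (swap z (+ n) (+ l))) (periodic g (z - + l))) (periodic-reflected h k z)

  ⊛-distribˡ : ∀ f g h → f ⊛ (g ⊕ h) ≐ f ⊛ g ⊕ f ⊛ h
  ⊛-distribˡ f g h k = trans (∑-cong n (λ i → ℤ.*-distribˡ-+ (coeff f (+ i)) _ _)) (∑-distrib-+ n _ _)

  ⊛-identityˡ : ∀ f → 𝟙 ⊛ f ≐ f
  ⊛-identityˡ f k = trans (ι-⊛ 1ℤ f k) (ℤ.*-identityˡ (coeff f k))

  𝟘-coeff : ∀ k → coeff 𝟘 k ≡ 0ℤ
  𝟘-coeff k = ℤ.*-zeroˡ (δ k)

  ring : ℕ → CommutativeRing 0ℓ 0ℓ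
  ring M = record
    { Carrier = ℤ[Cₙ] ; _≈_ = _≈[ M ]_ ; _+_ = _⊕_ ; _*_ = _⊛_ ; -_ = ⊝_ ; 0# = 𝟘 ; 1# = 𝟙
    ; isCommutativeRing = record
      { isRing = record
        { +-isAbelianGroup = record
          { isGroup = record
            { isMonoid = record
              { isSemigroup = record
                { isMagma = record { isEquivalence = ≈-isEquivalence ; ∙-cong = ⊕-cong }
                ; assoc = λ f g h → exact (λ k → ℤ.+-assoc (coeff f k) (coeff g k) (coeff h k)) }
              ; identity = (λ f → exact (λ k → trans (cong (_+ coeff f k) (𝟘-coeff k)) (ℤ.+-identityˡ (coeff f k))))
                         , (λ f → exact (λ k → trans (cong (_+_ (coeff f k)) (𝟘-coeff k)) (ℤ.+-identityʳ (coeff f k)))) }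
            ; inverse = (λ f → exact (λ k → trans (ℤ.+-inverseˡ (coeff f k)) (sym (𝟘-coeff k))))
                      , (λ f → exact (λ k → trans (ℤ.+-inverseʳ (coeff f k)) (sym (𝟘-coeff k))))
            ; ⁻¹-cong = ⊝-cong }
          ; comm = λ f g → exact (λ k → ℤ.+-comm (coeff f k) (coeff g k)) }
        ; *-cong = ⊛-cong
        ; *-assoc = λ f g h → exact (⊛-assoc f g h)
        ; *-identity = (λ f → exact (⊛-identityˡ f)) , (λ f → exact (λ k → trans (⊛-comm f 𝟙 k) (⊛-identityˡ f k)))
        ; distrib = (λ f g h → exact (⊛-distribˡ f g h))
                  , (λ f g h → exact (λ k → trans (⊛-comm (g ⊕ h) f k)
                                          (trans (⊛-distribˡ f g h k) (cong₂ _+_ (⊛-comm f g k) (⊛-comm f h k))))) }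
      ; *-comm = λ f g → exact (⊛-comm f g) } }
    where
    exact : ∀ {f g} → f ≐ g → f ≈[ M ] g
    exact = ≐⇒≈ M
    ≈-isEquivalence : IsEquivalence _≈[ M ]_
    ≈-isEquivalence = record { refl = ≈-refl ; sym = ≈-sym ; trans = ≈-trans }

  ι-homomorphism : ∀ M → ℤ.+-*-rawRing ACR.-Raw-AlmostCommutative⟶ ACR.fromCommutativeRing (ring M)
  ι-homomorphism M = record
    { ⟦_⟧    = ι
    ; +-homo = λ a b → ≐⇒≈ M (λ k → ℤ.*-distribʳ-+ (δ k) a b)
    ; *-homo = λ a b → ≐⇒≈ M (λ k → trans (ℤ.*-assoc a b (δ k)) (sym (ι-⊛ a (ι b) k)))
    ; -‿homo = λ a → ≐⇒≈ M (λ k → sym (ℤ.neg-distribˡ-* a (δ k)))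
    ; 0-homo = ≈-refl
    ; 1-homo = ≈-refl
    }

  ι-≟ : ∀ M → WeaklyDecidable (ACR.Induced-equivalence (ι-homomorphism M))
  ι-≟ M a b = Maybe.map ι-cong (dec⇒weaklyDec ℤ._≟_ a b)
    where
    ι-cong : a ≡ b → ι a ≈[ M ] ι b
    ι-cong refl = ≈-refl

  module ≈-Reasoning (M : ℕ) where
    open Solver ℤ.+-*-rawRing (ACR.fromCommutativeRing (ring M)) (ι-homomorphism M) (ι-≟ M) public
    open import Relation.Binary.Reasoning.Setoid (CommutativeRing.setoid (ring M)) public

  ≈𝟘⇒∣ : ∀ {f M} → f ≈[ M ] 𝟘 → ∀ k → + M ∣ℤ coeff f k
  ≈𝟘⇒∣ {f} (coeffwise M∣f-0) k =
    subst (_ ∣ℤ_) (trans (cong (λ z → coeff f k - z) (𝟘-coeff k)) (ℤ.+-identityʳ (coeff f k))) (M∣f-0 k)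

  ∣⇒≈𝟘 : ∀ {f M} → (∀ k → + M ∣ℤ coeff f k) → f ≈[ M ] 𝟘
  ∣⇒≈𝟘 {f} M∣f = coeffwise (λ k →
    subst (_ ∣ℤ_) (sym (trans (cong (λ z → coeff f k - z) (𝟘-coeff k)) (ℤ.+-identityʳ (coeff f k)))) (M∣f k))

  ⊖≈𝟘⇒≈ : ∀ {f g M} → f ⊖ g ≈[ M ] 𝟘 → f ≈[ M ] g
  ⊖≈𝟘⇒≈ f⊖g≈0 = coeffwise (≈𝟘⇒∣ f⊖g≈0)

  ≈⇒⊖≈𝟘 : ∀ {f g M} → f ≈[ M ] g → f ⊖ g ≈[ M ] 𝟘
  ≈⇒⊖≈𝟘 f≈g = ∣⇒≈𝟘 (coeff-∣ f≈g)

  ι-≈𝟘 : ∀ M → ι (+ M) ≈[ M ] 𝟘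
  ι-≈𝟘 M = ∣⇒≈𝟘 (λ k → Signed.∣m⇒∣m*n (δ k) Signed.∣-refl)

  ⊛-≈𝟘 : ∀ {f g M M′} → f ≈[ M ] 𝟘 → g ≈[ M′ ] 𝟘 → f ⊛ g ≈[ M ℕ.* M′ ] 𝟘
  ⊛-≈𝟘 {f} {g} {M} {M′} f≈0 g≈0 =
    ∣⇒≈𝟘 (λ k → subst (_∣ℤ _) (sym (ℤ.pos-* M M′)) (∣ℤ-∑ n (λ i _ → termwise (+ i) (k - + i))))
    where
    termwise : ∀ i j → + M * + M′ ∣ℤ coeff f i * coeff g j
    termwise i j = Signed.∣-trans (Signed.*-monoʳ-∣ (+ M) (≈𝟘⇒∣ g≈0 j)) (Signed.*-monoˡ-∣ (coeff g j) (≈𝟘⇒∣ f≈0 i))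

  ⊛-≈𝟘ʳ : ∀ {f g M} → g ≈[ M ] 𝟘 → f ⊛ g ≈[ M ] 𝟘
  ⊛-≈𝟘ʳ {f} {M = M} g≈0 = ≈-trans (⊛-cong ≈-refl g≈0) (solve 1 (λ f → f :* con 0ℤ := con 0ℤ) ≈-refl f)
    where open ≈-Reasoning M

  infixr 8 _⊛^_
  _⊛^_ : ℤ[Cₙ] → ℕ → ℤ[Cₙ]
  f ⊛^ zero  = 𝟙
  f ⊛^ suc m = f ⊛ f ⊛^ m

  geometric : ℤ[Cₙ] → ℤ[Cₙ] → ℕ → ℤ[Cₙ]
  geometric f g zero    = 𝟘
  geometric f g (suc m) = f ⊛ geometric f g m ⊕ g ⊛^ m

  module _ {M : ℕ} where
    open ≈-Reasoning M

    ⊛^-cong : ∀ {f g} m → f ≈[ M ] g → f ⊛^ m ≈[ M ] g ⊛^ m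
    ⊛^-cong zero    _   = ≈-refl
    ⊛^-cong (suc m) f≈g = ⊛-cong f≈g (⊛^-cong m f≈g)

    ⊛^-+ : ∀ f a b → f ⊛^ (a ℕ.+ b) ≈[ M ] f ⊛^ a ⊛ f ⊛^ b
    ⊛^-+ f zero    b = solve 1 (λ F → F := con 1ℤ :* F) ≈-refl (f ⊛^ b)
    ⊛^-+ f (suc a) b = begin
      f ⊛ f ⊛^ (a ℕ.+ b)       ≈⟨ ⊛-cong ≈-refl (⊛^-+ f a b) ⟩
      f ⊛ (f ⊛^ a ⊛ f ⊛^ b)    ≈⟨ solve 3 (λ f F G → f :* (F :* G) := f :* F :* G) ≈-refl f (f ⊛^ a) (f ⊛^ b) ⟩
      f ⊛ f ⊛^ a ⊛ f ⊛^ b      ∎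

    ⊛^-* : ∀ f a b → f ⊛^ (a ℕ.* b) ≈[ M ] (f ⊛^ b) ⊛^ a
    ⊛^-* f zero    b = ≈-refl
    ⊛^-* f (suc a) b = ≈-trans (⊛^-+ f b (a ℕ.* b)) (⊛-cong ≈-refl (⊛^-* f a b))

    ⊛^-distrib-⊛ : ∀ f g m → (f ⊛ g) ⊛^ m ≈[ M ] f ⊛^ m ⊛ g ⊛^ m
    ⊛^-distrib-⊛ f g zero    = solve 0 (con 1ℤ := con 1ℤ :* con 1ℤ) ≈-refl
    ⊛^-distrib-⊛ f g (suc m) = begin
      f ⊛ g ⊛ (f ⊛ g) ⊛^ m
        ≈⟨ ⊛-cong ≈-refl (⊛^-distrib-⊛ f g m) ⟩
      f ⊛ g ⊛ (f ⊛^ m ⊛ g ⊛^ m)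
        ≈⟨ solve 4 (λ f g F G → f :* g :* (F :* G) := f :* F :* (g :* G)) ≈-refl f g (f ⊛^ m) (g ⊛^ m) ⟩
      f ⊛ f ⊛^ m ⊛ (g ⊛ g ⊛^ m)
        ∎

    ⊛^-difference : ∀ f g m → f ⊛^ m ⊖ g ⊛^ m ≈[ M ] (f ⊖ g) ⊛ geometric f g m
    ⊛^-difference f g zero    = solve 2 (λ f g → con 1ℤ :- con 1ℤ := (f :- g) :* con 0ℤ) ≈-refl f g
    ⊛^-difference f g (suc m) = begin
      f ⊛ f ⊛^ m ⊖ g ⊛ g ⊛^ m
        ≈⟨ solve 4 (λ f g F G → f :* F :- g :* G := f :* (F :- G) :+ (f :- g) :* G) ≈-refl f g (f ⊛^ m) (g ⊛^ m) ⟩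
      f ⊛ (f ⊛^ m ⊖ g ⊛^ m) ⊕ (f ⊖ g) ⊛ g ⊛^ m
        ≈⟨ ⊕-cong (⊛-cong ≈-refl (⊛^-difference f g m)) ≈-refl ⟩
      f ⊛ ((f ⊖ g) ⊛ S) ⊕ (f ⊖ g) ⊛ g ⊛^ m
        ≈⟨ solve 4 (λ f g S G → f :* ((f :- g) :* S) :+ (f :- g) :* G := (f :- g) :* (f :* S :+ G)) ≈-refl f g S (g ⊛^ m) ⟩
      (f ⊖ g) ⊛ (f ⊛ S ⊕ g ⊛^ m)
        ∎
      where S = geometric f g m

    geometric-≈ : ∀ {f g} → f ≈[ M ] g → ∀ m → geometric f g (suc m) ≈[ M ] ι (+ suc m) ⊛ g ⊛^ m
    geometric-≈ {f} {g} f≈g zero    = solve 1 (λ f → f :* con 0ℤ :+ con 1ℤ := con 1ℤ :* con 1ℤ) ≈-refl f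
    geometric-≈ {f} {g} f≈g (suc m) = begin
      f ⊛ geometric f g (suc m) ⊕ g ⊛ g ⊛^ m
        ≈⟨ ⊕-cong (⊛-cong f≈g (geometric-≈ f≈g m)) ≈-refl ⟩
      g ⊛ (ι (+ suc m) ⊛ g ⊛^ m) ⊕ g ⊛ g ⊛^ m
        ≈⟨ solve 3 (λ c g G → g :* (c :* G) :+ g :* G := (c :+ con 1ℤ) :* (g :* G)) ≈-refl (ι (+ suc m)) g (g ⊛^ m) ⟩
      (ι (+ suc m) ⊕ 𝟙) ⊛ (g ⊛ g ⊛^ m)
        ≈⟨ ⊛-cong (≐⇒≈ M (λ k → sym (ℤ.*-distribʳ-+ (δ k) (+ suc m) 1ℤ))) ≈-refl ⟩
      ι (+ suc m + 1ℤ) ⊛ (g ⊛ g ⊛^ m)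
        ≡⟨ cong (λ c → ι (+ c) ⊛ (g ⊛ g ⊛^ m)) (ℕ.+-comm (suc m) 1) ⟩
      ι (+ suc (suc m)) ⊛ (g ⊛ g ⊛^ m)
        ∎

  -- f^P − g^P = (f − g)(f^(P−1) + ⋯ + g^(P−1)), and the second factor is ≡ P g^(P−1) ≡ 0 modulo P.
  ⊛^-lift : ∀ {f g M} P → P ∣ℕ M → f ≈[ M ] g → f ⊛^ P ≈[ M ℕ.* P ] g ⊛^ P
  ⊛^-lift {f} {g} {M} P P∣M f≈g =
    ⊖≈𝟘⇒≈ (≈-trans (⊛^-difference f g P) (⊛-≈𝟘 (≈⇒⊖≈𝟘 f≈g) (geometric≈𝟘 P P∣M)))
    where
    geometric≈𝟘 : ∀ P → P ∣ℕ M → geometric f g P ≈[ P ] 𝟘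
    geometric≈𝟘 zero    _   = ≈-refl
    geometric≈𝟘 (suc m) P∣M = begin
      geometric f g (suc m)    ≈⟨ geometric-≈ (≈-weaken P∣M f≈g) m ⟩
      ι (+ suc m) ⊛ g ⊛^ m     ≈⟨ ⊛-cong (ι-≈𝟘 (suc m)) ≈-refl ⟩
      𝟘 ⊛ g ⊛^ m               ≈⟨ solve 1 (λ G → con 0ℤ :* G := con 0ℤ) ≈-refl (g ⊛^ m) ⟩
      𝟘                        ∎
      where open ≈-Reasoning (suc m)

  ⊛^-lift-iterate : ∀ {f g P} i → f ≈[ P ] g → f ⊛^ (P ^ i) ≈[ P ^ suc i ] g ⊛^ (P ^ i)
  ⊛^-lift-iterate {P = P} zero f≈g = ⊛-cong (≈-weaken (∣-reflexive (ℕ.*-identityʳ P)) f≈g) ≈-refl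
  ⊛^-lift-iterate {f} {g} {P} (suc i) f≈g = begin
    f ⊛^ (P ^ suc i)
      ≈⟨ ⊛^-* f P (P ^ i) ⟩
    (f ⊛^ (P ^ i)) ⊛^ P
      ≈⟨ ≈-weaken (∣-reflexive (ℕ.*-comm P (P ^ suc i))) (⊛^-lift P (m∣m*n (P ^ i)) (⊛^-lift-iterate i f≈g)) ⟩
    (g ⊛^ (P ^ i)) ⊛^ P
      ≈⟨ ⊛^-* g P (P ^ i) ⟨
    g ⊛^ (P ^ suc i)
      ∎
    where open ≈-Reasoning (P ^ suc (suc i))

  ⊛^-idempotent : ∀ {g M} m .{{_ : NonZero m}} → g ⊛ g ≈[ M ] g → g ⊛^ m ≈[ M ] g
  ⊛^-idempotent {g} (suc zero)    _     = solve 1 (λ g → g :* con 1ℤ := g) ≈-refl g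
    where open ≈-Reasoning _
  ⊛^-idempotent {g} (suc (suc m)) g⊛g≈g = ≈-trans (⊛-cong ≈-refl (⊛^-idempotent (suc m) g⊛g≈g)) g⊛g≈g

  ⊛^[1+m]≈⇒⊛^m-idempotent : ∀ {y M} m → y ⊛^ suc m ≈[ M ] y → y ⊛^ m ⊛ y ⊛^ m ≈[ M ] y ⊛^ m
  ⊛^[1+m]≈⇒⊛^m-idempotent zero _ = solve 0 (con 1ℤ :* con 1ℤ := con 1ℤ) ≈-refl
    where open ≈-Reasoning _
  ⊛^[1+m]≈⇒⊛^m-idempotent {y} {M} (suc m) y^[2+m]≈y = begin
    y ⊛ y ⊛^ m ⊛ (y ⊛ y ⊛^ m)   ≈⟨ solve 2 (λ y Y → y :* Y :* (y :* Y) := Y :* (y :* (y :* Y))) ≈-refl y (y ⊛^ m) ⟩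
    y ⊛^ m ⊛ y ⊛^ suc (suc m)    ≈⟨ ⊛-cong ≈-refl y^[2+m]≈y ⟩
    y ⊛^ m ⊛ y                   ≈⟨ solve 2 (λ y Y → Y :* y := y :* Y) ≈-refl y (y ⊛^ m) ⟩
    y ⊛ y ⊛^ m                   ∎
    where open ≈-Reasoning M

  ⊛^⊛-≈𝟘 : ∀ {g h M} m .{{_ : NonZero m}} → g ⊛ h ≈[ M ] 𝟘 → g ⊛^ m ⊛ h ≈[ M ] 𝟘
  ⊛^⊛-≈𝟘 {g} {h} {M} (suc m) g⊛h≈0 = begin
    g ⊛ g ⊛^ m ⊛ h     ≈⟨ solve 3 (λ g G h → g :* G :* h := G :* (g :* h)) ≈-refl g (g ⊛^ m) h ⟩
    g ⊛^ m ⊛ (g ⊛ h)   ≈⟨ ⊛-≈𝟘ʳ g⊛h≈0 ⟩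
    𝟘                  ∎
    where open ≈-Reasoning M

  module _ {p c} (p-prime : Prime p) (p∤c : ¬ p ∣ℕ c) where

    ι-cancel : ∀ j {Z} → ι (+ c) ⊛ Z ≈[ p ^ j ] 𝟘 → Z ≈[ p ^ j ] 𝟘
    ι-cancel j {Z} cZ≈0 = ∣⇒≈𝟘 (λ k → Signed.∣ᵤ⇒∣ (p^j∣c*z⇒p^j∣z p-prime p∤c j (p^j∣c*|z| k)))
      where
      p^j∣c*|z| : ∀ k → p ^ j ∣ℕ c ℕ.* ℤ.∣ coeff Z k ∣
      p^j∣c*|z| k = subst (p ^ j ∣ℕ_) (ℤ.abs-* (+ c) (coeff Z k))
        (Signed.∣⇒∣ᵤ (subst (_ ∣ℤ_) (ι-⊛ (+ c) Z k) (≈𝟘⇒∣ cZ≈0 k)))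

    -- Induction on j: c is a unit modulo p, and Z ≡ 0 mod pʲ gives Z³ ≡ 0 mod pʲ⁺¹.
    ≈𝟘-lift : ∀ j {Z} → Z ≈[ p ] 𝟘 → Z ⊛ (Z ⊛ Z) ≈[ p ^ j ] ι (+ c) ⊛ (ι (+ c) ⊛ Z) → Z ≈[ p ^ j ] 𝟘
    ≈𝟘-lift zero    _   _       = ∣⇒≈𝟘 (λ k → Signed.∣ᵤ⇒∣ (1∣ _))
    ≈𝟘-lift (suc j) Z≈0 Z³≈c²Z = ι-cancel (suc j) (ι-cancel (suc j) (≈-trans (≈-sym Z³≈c²Z) Z³≈0))
      where
      Z³≈0 = ⊛-≈𝟘 Z≈0 (⊛-≈𝟘ʳ (≈𝟘-lift j Z≈0 (≈-weaken (n∣m*n p) Z³≈c²Z)))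

    c-idempotents-≈-lift : ∀ j {A B} → A ⊛ A ≈[ p ^ j ] ι (+ c) ⊛ A → B ⊛ B ≈[ p ^ j ] ι (+ c) ⊛ B →
                           A ≈[ p ] B → A ≈[ p ^ j ] B
    c-idempotents-≈-lift j {A} {B} A²≈cA B²≈cB A≈B = ⊖≈𝟘⇒≈ (≈𝟘-lift j (≈⇒⊖≈𝟘 A≈B) (begin
      (A ⊖ B) ⊛ ((A ⊖ B) ⊛ (A ⊖ B))
        ≈⟨ solve 2 (λ A B → (A :- B) :* ((A :- B) :* (A :- B))
                         := A :* A :* (A :- con (+ 3) :* B) :+ B :* B :* (con (+ 3) :* A :- B)) ≈-refl A B ⟩
      A ⊛ A ⊛ (A ⊖ ι (+ 3) ⊛ B) ⊕ B ⊛ B ⊛ (ι (+ 3) ⊛ A ⊖ B)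
        ≈⟨ ⊕-cong (⊛-cong A²≈cA ≈-refl) (⊛-cong B²≈cB ≈-refl) ⟩
      γ ⊛ A ⊛ (A ⊖ ι (+ 3) ⊛ B) ⊕ γ ⊛ B ⊛ (ι (+ 3) ⊛ A ⊖ B)
        ≈⟨ solve 3 (λ γ A B → γ :* A :* (A :- con (+ 3) :* B) :+ γ :* B :* (con (+ 3) :* A :- B)
                           := γ :* (A :* A :- B :* B)) ≈-refl γ A B ⟩
      γ ⊛ (A ⊛ A ⊖ B ⊛ B)
        ≈⟨ ⊛-cong ≈-refl (⊕-cong A²≈cA (⊝-cong B²≈cB)) ⟩
      γ ⊛ (γ ⊛ A ⊖ γ ⊛ B)
        ≈⟨ solve 3 (λ γ A B → γ :* (γ :* A :- γ :* B) := γ :* (γ :* (A :- B))) ≈-refl γ A B ⟩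
      γ ⊛ (γ ⊛ (A ⊖ B))
        ∎))
      where
      γ = ι (+ c)
      open ≈-Reasoning (p ^ j)

  y : ℤ[Cₙ]
  y = 𝟙 ⊕ X

  y-⊛ : ∀ f k → coeff (y ⊛ f) k ≡ coeff f k + coeff f (k - 1ℤ)
  y-⊛ f k = begin
    ∑[ i < n ] ((coeff 𝟙 (+ i) + coeff X (+ i)) * coeff f (k - + i))
      ≡⟨ ∑-cong n (λ i → ℤ.*-distribʳ-+ (coeff f (k - + i)) (coeff 𝟙 (+ i)) _) ⟩
    ∑[ i < n ] (coeff 𝟙 (+ i) * coeff f (k - + i) + coeff X (+ i) * coeff f (k - + i))
      ≡⟨ ∑-distrib-+ n _ _ ⟩
    coeff (𝟙 ⊛ f) k + coeff (X ⊛ f) k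
      ≡⟨ cong₂ _+_ (⊛-identityˡ f k) (X-⊛ f k) ⟩
    coeff f k + coeff f (k - 1ℤ)
      ∎
    where open ≡-Reasoning

  binomial : ℕ → ℤ → ℕ → ℤ
  binomial a k i = + (a C i) * δ (k - + i)

  ∑-binomial-pascal : ∀ a k → ∑< (suc (suc a)) (binomial (suc a) k)
                               ≡ ∑< (suc a) (binomial a k) + ∑< (suc a) (binomial a (k - 1ℤ))
  ∑-binomial-pascal a k = begin
    binomial a k 0 + ∑[ i < suc a ] binomial (suc a) k (suc i)
      ≡⟨ cong (_+_ (binomial a k 0)) (∑-cong (suc a) step) ⟩
    binomial a k 0 + ∑[ i < suc a ] (binomial a k (suc i) + binomial a (k - 1ℤ) i)
      ≡⟨ cong (_+_ (binomial a k 0)) (∑-distrib-+ (suc a) (λ i → binomial a k (suc i)) (binomial a (k - 1ℤ))) ⟩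
    binomial a k 0 + (∑[ i < suc a ] binomial a k (suc i) + ∑< (suc a) (binomial a (k - 1ℤ)))
      ≡⟨ ℤ.+-assoc (binomial a k 0) _ _ ⟨
    ∑< (suc (suc a)) (binomial a k) + ∑< (suc a) (binomial a (k - 1ℤ))
      ≡⟨ cong (_+ ∑< (suc a) (binomial a (k - 1ℤ))) (∑-last (suc a) (binomial a k)) ⟩
    ∑< (suc a) (binomial a k) + binomial a k (suc a) + ∑< (suc a) (binomial a (k - 1ℤ))
      ≡⟨ cong (λ t → ∑< (suc a) (binomial a k) + t + ∑< (suc a) (binomial a (k - 1ℤ))) top≡0 ⟩
    ∑< (suc a) (binomial a k) + 0ℤ + ∑< (suc a) (binomial a (k - 1ℤ))
      ≡⟨ cong (_+ ∑< (suc a) (binomial a (k - 1ℤ))) (ℤ.+-identityʳ (∑< (suc a) (binomial a k))) ⟩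
    ∑< (suc a) (binomial a k) + ∑< (suc a) (binomial a (k - 1ℤ))
      ∎
    where
    open ≡-Reasoning
    regroup : ∀ k i → k - (1ℤ + i) ≡ k - 1ℤ - i
    regroup = ℤ-Solver.solve-∀
    step : ∀ i → binomial (suc a) k (suc i) ≡ binomial a k (suc i) + binomial a (k - 1ℤ) i
    step i = begin
      + (suc a C suc i) * δ (k - + suc i)
        ≡⟨ cong (λ c → + c * δ (k - + suc i)) (nCk+nC[k+1]≡[n+1]C[k+1] a i) ⟨
      + (a C i ℕ.+ a C suc i) * δ (k - + suc i)
        ≡⟨ ℤ.*-distribʳ-+ (δ (k - + suc i)) (+ (a C i)) (+ (a C suc i)) ⟩
      + (a C i) * δ (k - + suc i) + binomial a k (suc i)
        ≡⟨ cong (λ z → + (a C i) * δ z + binomial a k (suc i)) (regroup k (+ i)) ⟩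
      binomial a (k - 1ℤ) i + binomial a k (suc i)
        ≡⟨ ℤ.+-comm (binomial a (k - 1ℤ) i) (binomial a k (suc i)) ⟩
      binomial a k (suc i) + binomial a (k - 1ℤ) i
        ∎
    top≡0 : binomial a k (suc a) ≡ 0ℤ
    top≡0 = cong (λ c → + c * δ (k - + suc a)) (k>n⇒nCk≡0 (ℕ.n<1+n a))

  y⊛^-coeff : ∀ a k → coeff (y ⊛^ a) k ≡ ∑[ i < suc a ] binomial a k i
  y⊛^-coeff zero    k = sym (trans (ℤ.+-identityʳ _) (cong (λ z → 1ℤ * δ z) (ℤ.+-identityʳ k)))
  y⊛^-coeff (suc a) k = begin
    coeff (y ⊛ y ⊛^ a) k                                          ≡⟨ y-⊛ (y ⊛^ a) k ⟩
    coeff (y ⊛^ a) k + coeff (y ⊛^ a) (k - 1ℤ)                    ≡⟨ cong₂ _+_ (y⊛^-coeff a k) (y⊛^-coeff a (k - 1ℤ)) ⟩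
    ∑< (suc a) (binomial a k) + ∑< (suc a) (binomial a (k - 1ℤ))  ≡⟨ ∑-binomial-pascal a k ⟨
    ∑< (suc (suc a)) (binomial (suc a) k)                         ∎
    where open ≡-Reasoning

  y⊛^[1+n]≈y : ∀ {p} → (∀ j → 0 < j → j < suc n → p ∣ℕ suc n C j) → y ⊛^ suc n ≈[ p ] y
  y⊛^[1+n]≈y p∣[1+n]Cj = coeffwise (λ k → subst (_ ∣ℤ_) (sym (y⊛^[1+n]-y k)) (∣ℤ-∑ n (λ i i<n →
    Signed.∣m⇒∣m*n {m = + (suc n C suc i)} (δ (k - + suc i)) (Signed.∣ᵤ⇒∣ (p∣[1+n]Cj (suc i) (s≤s z≤n) (s≤s i<n))))))
    where
    inner : ℤ → ℤ
    inner k = ∑[ i < n ] binomial (suc n) k (suc i)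
    bottom : ∀ k → binomial (suc n) k 0 ≡ 1ℤ * δ k
    bottom k = cong (λ z → 1ℤ * δ z) (ℤ.+-identityʳ k)
    cancel : ∀ k m → k - (1ℤ + m) + m ≡ k - 1ℤ
    cancel = ℤ-Solver.solve-∀
    top : ∀ k → binomial (suc n) k (suc n) ≡ δ (k - 1ℤ)
    top k = begin
      + (suc n C suc n) * δ (k - + suc n)   ≡⟨ cong (λ c → + c * δ (k - + suc n)) (nCn≡1 (suc n)) ⟩
      1ℤ * δ (k - + suc n)                  ≡⟨ ℤ.*-identityˡ _ ⟩
      δ (k - (1ℤ + + n))                    ≡⟨ δ-periodic (k - (1ℤ + + n)) ⟨
      δ (k - (1ℤ + + n) + + n)              ≡⟨ cong δ (cancel k (+ n)) ⟩
      δ (k - 1ℤ)                            ∎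
      where open ≡-Reasoning
    outer : ∀ a m b → a + (m + b) - (a + b) ≡ m
    outer = ℤ-Solver.solve-∀
    y⊛^[1+n]-y : ∀ k → coeff (y ⊛^ suc n) k - coeff y k ≡ inner k
    y⊛^[1+n]-y k = begin
      coeff (y ⊛^ suc n) k - coeff y k
        ≡⟨ cong (_- coeff y k) (y⊛^-coeff (suc n) k) ⟩
      binomial (suc n) k 0 + ∑[ i < suc n ] binomial (suc n) k (suc i) - coeff y k
        ≡⟨ cong (λ t → binomial (suc n) k 0 + t - coeff y k) (∑-last n (λ i → binomial (suc n) k (suc i))) ⟩
      binomial (suc n) k 0 + (inner k + binomial (suc n) k (suc n)) - coeff y k
        ≡⟨ cong₂ (λ b t → b + (inner k + t) - coeff y k) (bottom k) (top k) ⟩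
      1ℤ * δ k + (inner k + δ (k - 1ℤ)) - (1ℤ * δ k + δ (k - 1ℤ))
        ≡⟨ outer (1ℤ * δ k) (inner k) (δ (k - 1ℤ)) ⟩
      inner k
        ∎
      where open ≡-Reasoning

  sumSym-multiples : ∀ a r i → i ≤ a → sumSym (a ℕ.+ ℤ.∣ r ∣) (λ b → [ + i ≟ b * + n - r ]) ≡ δ (+ i + r)
  sumSym-multiples a r i i≤a with + n Signed.∣? (+ i + r)
  ... | yes n∣i+r@(Signed.divides c i+r≡cn) = begin
    sumSym B (λ b → [ + i ≟ b * + n - r ])   ≡⟨ sumSym-cong B (λ b → [≟]-cong (⇒ b) (⇐ b)) ⟩
    sumSym B (λ b → [ b ≟ c ])               ≡⟨ sumSym-[≟] B |c|≤B ⟩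
    1ℤ                                       ≡⟨ δ-yes n∣i+r ⟨
    δ (+ i + r)                              ∎
    where
    open ≡-Reasoning
    B = a ℕ.+ ℤ.∣ r ∣
    cancel₁ : ∀ x r → x - r + r ≡ x
    cancel₁ = ℤ-Solver.solve-∀
    cancel₂ : ∀ x r → x + r - r ≡ x
    cancel₂ = ℤ-Solver.solve-∀
    ⇒ : ∀ b → + i ≡ b * + n - r → b ≡ c
    ⇒ b i≡bn-r = ℤ.*-cancelʳ-≡ b c (+ n) (trans (sym (cancel₁ (b * + n) r)) (trans (cong (_+ r) (sym i≡bn-r)) i+r≡cn))
    ⇐ : ∀ b → b ≡ c → + i ≡ b * + n - r
    ⇐ b refl = trans (sym (cancel₂ (+ i) r)) (cong (_- r) i+r≡cn)
    |c|≤B : ℤ.∣ c ∣ ≤ B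
    |c|≤B = ℕ.≤-trans (ℕ.m≤m*n ℤ.∣ c ∣ n) (ℕ.≤-trans |cn|≤|i+r|
      (ℕ.≤-trans (ℤ.∣i+j∣≤∣i∣+∣j∣ (+ i) r) (ℕ.+-monoˡ-≤ ℤ.∣ r ∣ i≤a)))
      where
      |cn|≤|i+r| = ℕ.≤-reflexive (trans (sym (ℤ.abs-* c (+ n))) (cong ℤ.∣_∣ (sym i+r≡cn)))
  ... | no n∤i+r = trans (sumSym-zero (a ℕ.+ ℤ.∣ r ∣) (λ b _ → [≟]-no (n∤i+r ∘ n∣i+r b))) (sym (δ-no n∤i+r))
    where
    cancel : ∀ x r → x - r + r ≡ x
    cancel = ℤ-Solver.solve-∀
    n∣i+r : ∀ b → + i ≡ b * + n - r → + n ∣ℤ + i + r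
    n∣i+r b i≡bn-r = Signed.divides b (trans (cong (_+ r) i≡bn-r) (cancel (b * + n) r))

  sumSym-binomℤ≡coeff : ∀ a r → sumSym (a ℕ.+ ℤ.∣ r ∣) (λ b → + binomℤ a (b * + n - r)) ≡ coeff (y ⊛^ a) (- r)
  sumSym-binomℤ≡coeff a r = begin
    sumSym B (λ b → + binomℤ a (b * + n - r))
      ≡⟨ sumSym-cong B (λ b → binomℤ-as-∑ a (b * + n - r)) ⟩
    sumSym B (λ b → ∑[ i < suc a ] (+ (a C i) * [ + i ≟ b * + n - r ]))
      ≡⟨ sumSym-∑ B (suc a) (λ i b → + (a C i) * [ + i ≟ b * + n - r ]) ⟩
    ∑[ i < suc a ] sumSym B (λ b → + (a C i) * [ + i ≟ b * + n - r ])
      ≡⟨ ∑-cong-< (suc a) (λ i i≤a → trans (sym (*-distribˡ-sumSym B (+ (a C i)) _)) (cong (+ (a C i) *_) (count i i≤a))) ⟩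
    ∑[ i < suc a ] binomial a (- r) i
      ≡⟨ y⊛^-coeff a (- r) ⟨
    coeff (y ⊛^ a) (- r)
      ∎
    where
    open ≡-Reasoning
    B = a ℕ.+ ℤ.∣ r ∣
    flip : ∀ i r → - (i + r) ≡ - r - i
    flip = ℤ-Solver.solve-∀
    count : ∀ i → i < suc a → sumSym B (λ b → [ + i ≟ b * + n - r ]) ≡ δ (- r - + i)
    count i i≤a = trans (sumSym-multiples a r i (ℕ.≤-pred i≤a)) (trans (sym (δ-neg (+ i + r))) (cong δ (flip (+ i) r)))

  module Alternating {p} (p∣1+[-1]ᵖ : + p ∣ℤ 1ℤ + negOnePow (+ p)) ([-1]ᵖⁿ≡1 : negOnePow (+ p * + n) ≡ 1ℤ) where

    d : ℤ → ℤ
    d k = negOnePow (+ p * k)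

    d-+ : ∀ a b → d (a + b) ≡ d a * d b
    d-+ a b = trans (cong negOnePow (ℤ.*-distribˡ-+ (+ p) a b)) (negOnePow-+ (+ p * a) (+ p * b))

    d-0 : d 0ℤ ≡ 1ℤ
    d-0 = cong negOnePow (ℤ.*-zeroʳ (+ p))

    d-inverse : ∀ k → d k * d (- k) ≡ 1ℤ
    d-inverse k = trans (sym (d-+ k (- k))) (trans (cong d (ℤ.+-inverseʳ k)) d-0)

    d-1 : d 1ℤ ≡ negOnePow (+ p)
    d-1 = cong negOnePow (ℤ.*-identityʳ (+ p))

    d[-1] : d -1ℤ ≡ negOnePow (+ p)
    d[-1] = trans (cong negOnePow (sym (ℤ.neg-distribʳ-* (+ p) 1ℤ))) (trans (negOnePow-neg (+ p * 1ℤ)) d-1)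

    D : ℤ[Cₙ]
    coeff    D = d
    periodic D k = trans (d-+ k (+ n)) (trans (cong (d k *_) [-1]ᵖⁿ≡1) (ℤ.*-identityʳ (d k)))

    D⊛D≈nD : ∀ {M} → D ⊛ D ≈[ M ] ι (+ n) ⊛ D
    D⊛D≈nD {M} = ≐⇒≈ M (λ k → begin
      ∑[ i < n ] (d (+ i) * d (k - + i))   ≡⟨ ∑-cong n (λ i → trans (sym (d-+ (+ i) (k - + i))) (cong d (cancel (+ i) k))) ⟩
      ∑[ i < n ] d k                       ≡⟨ ∑-const n (d k) ⟩
      + n * d k                            ≡⟨ ι-⊛ (+ n) D k ⟨
      coeff (ι (+ n) ⊛ D) k                ∎)
      where
      open ≡-Reasoning
      cancel : ∀ i k → i + (k - i) ≡ k
      cancel = ℤ-Solver.solve-∀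

    y⊛D≈𝟘 : y ⊛ D ≈[ p ] 𝟘
    y⊛D≈𝟘 = ∣⇒≈𝟘 (λ k → subst (_ ∣ℤ_) (sym (y⊛D-coeff k)) (Signed.∣n⇒∣m*n (d k) p∣1+[-1]ᵖ))
      where
      factor : ∀ a s → a + a * s ≡ a * (1ℤ + s)
      factor = ℤ-Solver.solve-∀
      y⊛D-coeff : ∀ k → coeff (y ⊛ D) k ≡ d k * (1ℤ + negOnePow (+ p))
      y⊛D-coeff k = begin
        coeff (y ⊛ D) k                ≡⟨ y-⊛ D k ⟩
        d k + d (k - 1ℤ)               ≡⟨ cong (_+_ (d k)) (trans (d-+ k -1ℤ) (cong (d k *_) d[-1])) ⟩
        d k + d k * negOnePow (+ p)    ≡⟨ factor (d k) (negOnePow (+ p)) ⟩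
        d k * (1ℤ + negOnePow (+ p))   ∎
        where open ≡-Reasoning

    coeff[Z⊛D-n⊛Z] : ∀ Z k → coeff (Z ⊛ D) k - coeff (ι (+ n) ⊛ Z) k
                     ≡ ∑[ i < n ] ((coeff Z (k + + i) - d (+ i) * coeff Z k) * d (- + i))
    coeff[Z⊛D-n⊛Z] Z k = begin
      coeff (Z ⊛ D) k - coeff (ι (+ n) ⊛ Z) k
        ≡⟨ cong₂ _-_ (∑-periodic-shift (convolution-periodic Z D k) k) (sym (ι-⊛ (+ n) Z k)) ⟨
      ∑[ i < n ] (z (k + + i) * d (k - (k + + i))) - + n * z k
        ≡⟨ cong₂ _-_ (∑-cong n (λ i → cong (λ t → z (k + + i) * d t) (cancel k (+ i))))
                     (sym (trans (∑-cong n unit) (∑-const n (z k)))) ⟩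
      ∑[ i < n ] (z (k + + i) * d (- + i)) - ∑[ i < n ] (d (+ i) * z k * d (- + i))
        ≡⟨ ∑-distrib-- n _ _ ⟨
      ∑[ i < n ] (z (k + + i) * d (- + i) - d (+ i) * z k * d (- + i))
        ≡⟨ ∑-cong n (λ i → factor (z (k + + i)) (d (+ i) * z k) (d (- + i))) ⟩
      ∑[ i < n ] ((z (k + + i) - d (+ i) * z k) * d (- + i))
        ∎
      where
      open ≡-Reasoning
      z = coeff Z
      cancel : ∀ k i → k - (k + i) ≡ - i
      cancel = ℤ-Solver.solve-∀
      factor : ∀ a b c → a * c - b * c ≡ (a - b) * c
      factor = ℤ-Solver.solve-∀
      rearrange : ∀ a b c → a * b * c ≡ b * (a * c)
      rearrange = ℤ-Solver.solve-∀
      unit : ∀ i → d (+ i) * z k * d (- + i) ≡ z k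
      unit i = trans (rearrange (d (+ i)) (z k) (d (- + i))) (trans (cong (z k *_) (d-inverse (+ i))) (ℤ.*-identityʳ (z k)))

    -- y ⊛ Z ≡ 0 says z(w) ≡ −z(w − 1), and −1 ≡ (−1)ᵖ modulo p.
    y⊛Z≈𝟘⇒coeff-shift : ∀ {Z} → y ⊛ Z ≈[ p ] 𝟘 → ∀ k i → + p ∣ℤ coeff Z (k + + i) - d (+ i) * coeff Z k
    y⊛Z≈𝟘⇒coeff-shift {Z} y⊛Z≈0 k zero    = Signed.divides 0ℤ (begin
      coeff Z (k + 0ℤ) - d 0ℤ * coeff Z k   ≡⟨ cong₂ (λ w e → coeff Z w - e * coeff Z k) (ℤ.+-identityʳ k) d-0 ⟩
      coeff Z k - 1ℤ * coeff Z k            ≡⟨ cong (λ t → coeff Z k - t) (ℤ.*-identityˡ (coeff Z k)) ⟩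
      coeff Z k - coeff Z k                 ≡⟨ ℤ.+-inverseʳ (coeff Z k) ⟩
      0ℤ                                    ∎)
      where open ≡-Reasoning
    y⊛Z≈𝟘⇒coeff-shift {Z} y⊛Z≈0 k (suc i) = subst (_ ∣ℤ_) regroup
      (Signed.∣m∣n⇒∣m-n (Signed.∣m∣n⇒∣m-n consecutive previous) (Signed.∣n⇒∣m*n (e * z k) p∣1+[-1]ᵖ))
      where
      open ≡-Reasoning
      z = coeff Z
      previous = y⊛Z≈𝟘⇒coeff-shift y⊛Z≈0 k i
      w = k + + suc i
      e = d (+ i)
      cancel : ∀ k i → k + (1ℤ + i) - 1ℤ ≡ k + i
      cancel = ℤ-Solver.solve-∀
      consecutive : + p ∣ℤ z w + z (k + + i)
      consecutive = subst (_ ∣ℤ_) (trans (y-⊛ Z w) (cong (λ t → z w + z t) (cancel k (+ i)))) (≈𝟘⇒∣ y⊛Z≈0 w)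
      identity : ∀ a b c e s → a + b - (b - e * c) - e * c * (1ℤ + s) ≡ a - s * e * c
      identity = ℤ-Solver.solve-∀
      regroup : z w + z (k + + i) - (z (k + + i) - e * z k) - e * z k * (1ℤ + negOnePow (+ p)) ≡ z w - d (+ suc i) * z k
      regroup = begin
        z w + z (k + + i) - (z (k + + i) - e * z k) - e * z k * (1ℤ + negOnePow (+ p))
          ≡⟨ identity (z w) (z (k + + i)) (z k) e (negOnePow (+ p)) ⟩
        z w - negOnePow (+ p) * e * z k
          ≡⟨ cong (λ t → z w - t * z k) (trans (cong (_* e) (sym d-1)) (sym (d-+ 1ℤ (+ i)))) ⟩
        z w - d (+ suc i) * z k
          ∎

    y⊛Z≈𝟘⇒Z⊛D≈n⊛Z : ∀ {Z} → y ⊛ Z ≈[ p ] 𝟘 → Z ⊛ D ≈[ p ] ι (+ n) ⊛ Z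
    y⊛Z≈𝟘⇒Z⊛D≈n⊛Z {Z} y⊛Z≈0 = coeffwise (λ k → subst (_ ∣ℤ_) (sym (coeff[Z⊛D-n⊛Z] Z k))
      (∣ℤ-∑ n (λ i _ → Signed.∣m⇒∣m*n (d (- + i)) (y⊛Z≈𝟘⇒coeff-shift y⊛Z≈0 k i))))

    G : ℤ[Cₙ]
    G = ι (+ n) ⊖ D

    G⊛G≈nG : ∀ {M} → G ⊛ G ≈[ M ] ι (+ n) ⊛ G
    G⊛G≈nG {M} = begin
      (ν ⊖ D) ⊛ (ν ⊖ D)
        ≈⟨ solve 2 (λ ν D → (ν :- D) :* (ν :- D) := ν :* ν :- ν :* D :- ν :* D :+ D :* D) ≈-refl ν D ⟩
      ν ⊛ ν ⊖ ν ⊛ D ⊖ ν ⊛ D ⊕ D ⊛ D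
        ≈⟨ ⊕-cong ≈-refl D⊛D≈nD ⟩
      ν ⊛ ν ⊖ ν ⊛ D ⊖ ν ⊛ D ⊕ ν ⊛ D
        ≈⟨ solve 2 (λ ν D → ν :* ν :- ν :* D :- ν :* D :+ ν :* D := ν :* (ν :- D)) ≈-refl ν D ⟩
      ν ⊛ (ν ⊖ D)
        ∎
      where
      ν = ι (+ n)
      open ≈-Reasoning M

    G⊛D≈𝟘 : ∀ {M} → G ⊛ D ≈[ M ] 𝟘
    G⊛D≈𝟘 {M} = begin
      (ν ⊖ D) ⊛ D     ≈⟨ solve 2 (λ ν D → (ν :- D) :* D := ν :* D :- D :* D) ≈-refl ν D ⟩
      ν ⊛ D ⊖ D ⊛ D   ≈⟨ ⊕-cong ≈-refl (⊝-cong D⊛D≈nD) ⟩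
      ν ⊛ D ⊖ ν ⊛ D   ≈⟨ solve 1 (λ W → W :- W := con 0ℤ) ≈-refl (ν ⊛ D) ⟩
      𝟘               ∎
      where
      ν = ι (+ n)
      open ≈-Reasoning M

    -- Z = n yⁿ − G is annihilated by y and by D modulo p, which forces n Z ≡ 0.
    n⊛yⁿ≈G : Prime p → ¬ p ∣ℕ n → y ⊛^ suc n ≈[ p ] y → ι (+ n) ⊛ y ⊛^ n ≈[ p ] G
    n⊛yⁿ≈G p-prime p∤n yⁿ⁺¹≈y = ⊖≈𝟘⇒≈ (≈-weaken p∣p^1 (ι-cancel p-prime p∤n 1 (≈-weaken p^1∣p (begin
      ν ⊛ Z   ≈⟨ y⊛Z≈𝟘⇒Z⊛D≈n⊛Z y⊛Z≈𝟘 ⟨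
      Z ⊛ D   ≈⟨ Z⊛D≈𝟘 ⟩
      𝟘       ∎))))
      where
      open ≈-Reasoning p
      ν = ι (+ n)
      e = y ⊛^ n
      Z = ν ⊛ e ⊖ G
      p∣p^1 = ∣-reflexive (sym (ℕ.*-identityʳ p))
      p^1∣p = ∣-reflexive (ℕ.*-identityʳ p)
      y⊛Z≈𝟘 : y ⊛ Z ≈[ p ] 𝟘
      y⊛Z≈𝟘 = begin
        y ⊛ (ν ⊛ e ⊖ (ν ⊖ D))
          ≈⟨ solve 4 (λ y ν e D → y :* (ν :* e :- (ν :- D)) := ν :* (y :* e) :- ν :* y :+ y :* D) ≈-refl y ν e D ⟩
        ν ⊛ (y ⊛ e) ⊖ ν ⊛ y ⊕ y ⊛ D
          ≈⟨ ⊕-cong (⊕-cong (⊛-cong ≈-refl yⁿ⁺¹≈y) ≈-refl) y⊛D≈𝟘 ⟩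
        ν ⊛ y ⊖ ν ⊛ y ⊕ 𝟘
          ≈⟨ solve 2 (λ ν y → ν :* y :- ν :* y :+ con 0ℤ := con 0ℤ) ≈-refl ν y ⟩
        𝟘
          ∎
      Z⊛D≈𝟘 : Z ⊛ D ≈[ p ] 𝟘
      Z⊛D≈𝟘 = begin
        (ν ⊛ e ⊖ G) ⊛ D       ≈⟨ solve 4 (λ ν e G D → (ν :* e :- G) :* D := ν :* (e :* D) :- G :* D) ≈-refl ν e G D ⟩
        ν ⊛ (e ⊛ D) ⊖ G ⊛ D   ≈⟨ ⊕-cong (⊛-cong ≈-refl (⊛^⊛-≈𝟘 n y⊛D≈𝟘)) (⊝-cong G⊛D≈𝟘) ⟩
        ν ⊛ 𝟘 ⊖ 𝟘             ≈⟨ solve 1 (λ ν → ν :* con 0ℤ :- con 0ℤ := con 0ℤ) ≈-refl ν ⟩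
        𝟘                     ∎

module _ {p e n} (p-prime : Prime p) (1+n≡q : suc n ≡ p ^ suc e) .{{_ : NonZero n}} where
  open CyclicRing n
  open Alternating (p∣1+negOnePow[p] p-prime) (negOnePow[p*n]≡1 p-prime e 1+n≡q)

  private
    instance
      p≢0 : NonZero p
      p≢0 = prime⇒nonZero p-prime

    p∤n : ¬ p ∣ℕ n
    p∤n p∣n = ℕ.nonTrivial⇒≢1 {{prime⇒nonTrivial p-prime}} (∣1⇒≡1 (∣m+n∣m⇒∣n p∣n+1 p∣n))
      where
      p∣n+1 : p ∣ℕ n ℕ.+ 1
      p∣n+1 = subst (p ∣ℕ_) (trans (sym 1+n≡q) (ℕ.+-comm 1 n)) (m∣m*n (p ^ e))

    yⁿ⁺¹≈y : y ⊛^ suc n ≈[ p ] y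
    yⁿ⁺¹≈y = y⊛^[1+n]≈y (λ j 0<j j<1+n →
      subst (λ q → p ∣ℕ q C j) (sym 1+n≡q) (p∣[p^e]Cj p-prime (suc e) 0<j (subst (j <_) 1+n≡q j<1+n)))

    ε : ℤ[Cₙ]
    ε = y ⊛^ n

    ε⊛ε≈ε : ε ⊛ ε ≈[ p ] ε
    ε⊛ε≈ε = ⊛^[1+m]≈⇒⊛^m-idempotent n yⁿ⁺¹≈y

    E : ℕ → ℤ[Cₙ]
    E k = ε ⊛^ (p ^ k)

    E⊛E≈E : ∀ k → E k ⊛ E k ≈[ p ^ suc k ] E k
    E⊛E≈E k = ≈-trans (≈-sym (⊛^-distrib-⊛ ε ε (p ^ k))) (⊛^-lift-iterate k ε⊛ε≈ε)

    E≈ε : ∀ k → E k ≈[ p ] ε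
    E≈ε k = ⊛^-idempotent (p ^ k) {{ℕ.m^n≢0 p k}} ε⊛ε≈ε

    yᵃ≈E : ∀ k t → y ⊛^ (suc t ℕ.* (n ℕ.* p ^ k)) ≈[ p ^ suc k ] E k
    yᵃ≈E k t = begin
      y ⊛^ (suc t ℕ.* (n ℕ.* p ^ k))   ≈⟨ ⊛^-* y (suc t) (n ℕ.* p ^ k) ⟩
      (y ⊛^ (n ℕ.* p ^ k)) ⊛^ suc t    ≡⟨ cong (λ m → (y ⊛^ m) ⊛^ suc t) (ℕ.*-comm n (p ^ k)) ⟩
      (y ⊛^ (p ^ k ℕ.* n)) ⊛^ suc t    ≈⟨ ⊛^-cong (suc t) (⊛^-* y (p ^ k) n) ⟩
      E k ⊛^ suc t                     ≈⟨ ⊛^-idempotent (suc t) (E⊛E≈E k) ⟩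
      E k                              ∎
      where open ≈-Reasoning (p ^ suc k)

    nE⊛nE≈n⊛nE : ∀ k → ι (+ n) ⊛ E k ⊛ (ι (+ n) ⊛ E k) ≈[ p ^ suc k ] ι (+ n) ⊛ (ι (+ n) ⊛ E k)
    nE⊛nE≈n⊛nE k = begin
      ν ⊛ E k ⊛ (ν ⊛ E k)     ≈⟨ solve 2 (λ ν E → ν :* E :* (ν :* E) := ν :* (ν :* (E :* E))) ≈-refl ν (E k) ⟩
      ν ⊛ (ν ⊛ (E k ⊛ E k))   ≈⟨ ⊛-cong ≈-refl (⊛-cong ≈-refl (E⊛E≈E k)) ⟩
      ν ⊛ (ν ⊛ E k)           ∎
      where
      ν = ι (+ n)
      open ≈-Reasoning (p ^ suc k)

    n⊛yᵃ≈G : ∀ k t → ι (+ n) ⊛ y ⊛^ (suc t ℕ.* (n ℕ.* p ^ k)) ≈[ p ^ suc k ] G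
    n⊛yᵃ≈G k t =
      ≈-trans (⊛-cong ≈-refl (yᵃ≈E k t)) (c-idempotents-≈-lift p-prime p∤n (suc k) (nE⊛nE≈n⊛nE k) G⊛G≈nG nE≈G)
      where
      nE≈G : ι (+ n) ⊛ E k ≈[ p ] G
      nE≈G = ≈-trans (⊛-cong ≈-refl (E≈ε k)) (n⊛yⁿ≈G p-prime p∤n yⁿ⁺¹≈y)

  binomSum-congruence : ∀ k {a r} .{{_ : NonZero a}} → n ℕ.* p ^ k ∣ℕ a → ¬ + n ∣ℤ r →
    + (p ^ suc k) ∣ℤ + n * sumSym (a ℕ.+ ℤ.∣ r ∣) (λ b → + binomℤ a (b * + n - r)) - - negOnePow (+ p * r)
  binomSum-congruence k (divides zero refl) _ = contradiction refl (ℕ.≢-nonZero⁻¹ 0)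
  binomSum-congruence k {r = r} (divides (suc t) refl) n∤r =
    subst (_ ∣ℤ_) (cong₂ _-_ n⊛yᵃ-coeff G-coeff) (coeff-∣ (n⊛yᵃ≈G k t) (- r))
    where
    open ≡-Reasoning
    a = suc t ℕ.* (n ℕ.* p ^ k)
    n∤-r : ¬ + n ∣ℤ - r
    n∤-r n∣-r = n∤r (subst (+ n ∣ℤ_) (ℤ.neg-involutive r) (Signed.∣m⇒∣-m n∣-r))
    n⊛yᵃ-coeff : coeff (ι (+ n) ⊛ y ⊛^ a) (- r) ≡ + n * sumSym (a ℕ.+ ℤ.∣ r ∣) (λ b → + binomℤ a (b * + n - r))
    n⊛yᵃ-coeff = trans (ι-⊛ (+ n) (y ⊛^ a) (- r)) (cong (+ n *_) (sym (sumSym-binomℤ≡coeff a r)))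
    G-coeff : coeff G (- r) ≡ - negOnePow (+ p * r)
    G-coeff = begin
      + n * δ (- r) + - d (- r)    ≡⟨ cong (λ t → + n * t + - d (- r)) (δ-no n∤-r) ⟩
      + n * 0ℤ + - d (- r)         ≡⟨ cong (_+ - d (- r)) (ℤ.*-zeroʳ (+ n)) ⟩
      0ℤ + - d (- r)               ≡⟨ ℤ.+-identityˡ (- d (- r)) ⟩
      - d (- r)                    ≡⟨ cong (λ t → - negOnePow t) (ℤ.neg-distribʳ-* (+ p) r) ⟨
      - negOnePow (- (+ p * r))    ≡⟨ cong -_ (negOnePow-neg (+ p * r)) ⟩
      - negOnePow (+ p * r)        ∎

corollary1p3 : (p e k a : ℕ) (r : ℤ) → Prime p → (q : ℕ) → q ≡ p ^ e →
    ℕ.NonZero a → ((q ℕ.∸ 1) ℕ.* p ^ k) ∣ℕ a → ¬ ((+ q - + 1) ∣ r) →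
    (+ (p ^ (ℕ.suc k))) ∣ (((+ q - + 1) * binomSum a q r) - (- negOnePow (+ p * r)))
corollary1p3 p zero    k a r _       _ refl a≢0 0∣a _ = contradiction (0∣⇒≡0 0∣a) (ℕ.≢-nonZero⁻¹ a {{a≢0}})
corollary1p3 p (suc e) k a r p-prime _ refl a≢0 n*pᵏ∣a n∤r with p^[1+e]≡2+n p-prime e
... | n , q≡2+n rewrite q≡2+n =
  Signed.∣⇒∣ᵤ (binomSum-congruence {e = e} p-prime (sym q≡2+n) k {{a≢0}} n*pᵏ∣a (n∤r ∘ Signed.∣⇒∣ᵤ))
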